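{- $|\delta_5(n)|=O(\ln n)$ as $n\to\infty$.
   Context: $F_5:\mathbb{N}\to\mathbb{N}$ is defined by $F_5(0)=0$ and $F_5(n)=n-F_5^5(n-1)$ for $n\ge1$, where $F_5^5$ is the 5-fold iterate of $F_5$. $\alpha_5$ is the unique positive real zero of $X^5+X-1$ and $\delta_5(n)=F_5(n)-\alpha_5 n$. -}

module Defs where

open import Data.Nat using (ℕ; zero; suc; _+_)
open import Data.Integer using (ℤ; +_; _*_; _^_; _≤_)
  renaming (_+_ to _+ℤ_)
open import Relation.Binary.PropositionalEquality using (_≡_)

iter : (ℕ → ℕ) → ℕ → ℕ → ℕ
iter f zero    x = x
iter f (suc k) x = f (iter f k x)

-- F satisfies the defining recursion of F_5:
--   F(0) = 0,  F(n) = n - F^5(n-1) for n ≥ 1.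
-- (Stated additively, so no truncated subtraction is involved.)
IsF5 : (ℕ → ℕ) → Set
IsF5 F = (F 0 ≡ 0) × ((n : ℕ) → F (suc n) + iter F 5 n ≡ suc n)
  where open import Data.Product using (_×_)

-- α₅ = unique real root of X^5 + X - 1.  Since p(X) = X^5 + X - 1 is strictly
-- increasing on ℝ, and a ↦ a^5 + a·n^4 is strictly increasing on ℝ for every n,
-- for an integer a and natural n:
--   α₅n-≤ n a  (α₅·n ≤ a)  ⟺  n^5 ≤ a^5 + a·n^4
--   ≤-α₅n a n  (a ≤ α₅·n)  ⟺  a^5 + a·n^4 ≤ n^5
-- (because (α₅ n)^5 + (α₅ n) n^4 = n^5 p(α₅) + n^5 = n^5).
α₅n-≤ : ℕ → ℤ → Set
α₅n-≤ n a = (+ n) ^ 5 ≤ (a ^ 5 +ℤ a * (+ n) ^ 4)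

≤-α₅n : ℤ → ℕ → Set
≤-α₅n a n = (a ^ 5 +ℤ a * (+ n) ^ 4) ≤ (+ n) ^ 5

module Submission where

-- In the numeration system with base A = 1, 2, 3, 4, 5, 6, 8, … (A (n + 5) = A (n + 4) + A n),
-- F lowers every digit of a greedy expansion by one place.  So for any z / d,
-- d F n - z n is the sum, over the O(log n) digits A m of n, of d A (m - 1) - z A m.
-- Since X⁵ - X⁴ - 1 = (X³ - X - 1) (X² - X + 1), A splits into a Padovan sequence and
-- a sequence of period 6.  If z / d is within 1 / d of α₅ = lim A m / A (1 + m), then on
-- the Padovan part these errors are governed by the complex roots of X³ - X - 1, of
-- modulus √α₅ < 1, and stay O(d) as long as d is large compared with the digits:
-- a positive definite quadratic form in consecutive errors shrinks at each step.
-- Taking z / d just below and just above α₅ gives |F n - α₅ n| = O(log n).  All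
-- comparisons with α₅ go through X³ + X² - 1, which α₅ also solves since
-- X⁵ + X - 1 = (X² - X + 1) (X³ + X² - 1).

module Arithmetic where

  open import Data.Nat as ℕ using (ℕ; suc)
  import Data.Nat.Properties as ℕ
  open import Data.Integer hiding (suc)
  open import Data.Integer.Properties
  open import Data.Sum using (inj₁; inj₂)
  open import Relation.Binary.PropositionalEquality
  open import Relation.Nullary.Negation using (contradiction)

  ≤-suc⇒mono-≤ : ∀ (f : ℕ → ℕ) → (∀ n → f n ℕ.≤ f (suc n)) → ∀ {m n} → m ℕ.≤ n → f m ℕ.≤ f n
  ≤-suc⇒mono-≤ f f-≤-suc m≤n = go (ℕ.≤⇒≤′ m≤n)
    where
    go : ∀ {m n} → m ℕ.≤′ n → f m ℕ.≤ f n
    go ℕ.≤′-refl              = ℕ.≤-refl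
    go (ℕ.≤′-step {n} m≤′n) = ℕ.≤-trans (go m≤′n) (f-≤-suc n)

  m*m≤n*n⇒m≤n : ∀ {m n} → m ℕ.* m ℕ.≤ n ℕ.* n → m ℕ.≤ n
  m*m≤n*n⇒m≤n {m} {n} m²≤n² with ℕ.≤-<-connex m n
  ... | inj₁ m≤n = m≤n
  ... | inj₂ n<m = contradiction m²≤n² (ℕ.<⇒≱ (ℕ.*-mono-< n<m n<m))

  ∣m-n∣≤o⇒m≤o+n : ∀ {m n o} → ℕ.∣ m - n ∣ ℕ.≤ o → m ℕ.≤ o ℕ.+ n
  ∣m-n∣≤o⇒m≤o+n {m} {n} ∣m-n∣≤o = ℕ.≤-trans (ℕ.m≤∣m-n∣+n m n) (ℕ.+-monoˡ-≤ n ∣m-n∣≤o)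

  ∣m-n∣≤o⇒n≤o+m : ∀ {m n o} → ℕ.∣ m - n ∣ ℕ.≤ o → n ℕ.≤ o ℕ.+ m
  ∣m-n∣≤o⇒n≤o+m {m} {n} ∣m-n∣≤o = ∣m-n∣≤o⇒m≤o+n (subst (ℕ._≤ _) (ℕ.∣-∣-comm m n) ∣m-n∣≤o)

  i≤+∣i∣ : ∀ i → i ≤ + ∣ i ∣
  i≤+∣i∣ (+ n)    = ≤-refl
  i≤+∣i∣ -[1+ n ] = -≤+

  +m≡+n+i⇒m≤n+∣i∣ : ∀ {m n i} → + m ≡ + n + i → m ℕ.≤ n ℕ.+ ∣ i ∣
  +m≡+n+i⇒m≤n+∣i∣ {_} {n} {i} eq =
    drop‿+≤+ (subst₂ _≤_ (sym eq) (sym (pos-+ n ∣ i ∣)) (+-monoʳ-≤ (+ n) (i≤+∣i∣ i)))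

  +k*i≡+n⇒i≡+∣i∣ : ∀ k {i n} .{{_ : ℕ.NonZero k}} → + k * i ≡ + n → i ≡ + ∣ i ∣
  +k*i≡+n⇒i≡+∣i∣ (suc k) {+ i}      _  = refl
  +k*i≡+n⇒i≡+∣i∣ (suc k) { -[1+ i ]} ()

  ∣+m-+n∣≡∣m-n∣ : ∀ m n → ∣ + m - + n ∣ ≡ ℕ.∣ m - n ∣
  ∣+m-+n∣≡∣m-n∣ m n with ℕ.≤-total m n
  ... | inj₁ m≤n = trans (cong ∣_∣ (m-n≡m⊖n m n)) (trans (∣⊖∣-≤ m≤n) (sym (ℕ.m≤n⇒∣m-n∣≡n∸m m≤n)))
  ... | inj₂ n≤m = trans (cong ∣_∣ (m-n≡m⊖n m n)) (trans (cong ∣_∣ (⊖-≥ n≤m)) (sym (ℕ.m≤n⇒∣n-m∣≡n∸m n≤m)))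

  i*i≡+∣i∣*∣i∣ : ∀ i → i * i ≡ + (∣ i ∣ ℕ.* ∣ i ∣)
  i*i≡+∣i∣*∣i∣ (+ n)    = sym (pos-* n n)
  i*i≡+∣i∣*∣i∣ -[1+ n ] = refl

  pos-*³ : ∀ a b c → + (a ℕ.* b ℕ.* c) ≡ + a * + b * + c
  pos-*³ a b c = trans (pos-* (a ℕ.* b) c) (cong (_* + c) (pos-* a b))

  +m-+n≤+[m∸k] : ∀ {m n k} → k ℕ.≤ n → + m - + n ≤ + (m ℕ.∸ k)
  +m-+n≤+[m∸k] {m} {n} k≤n with ℕ.≤-total n m
  ... | inj₁ n≤m = subst (_≤ _) (sym (trans (m-n≡m⊖n m n) (⊖-≥ n≤m))) (+≤+ (ℕ.∸-monoʳ-≤ m k≤n))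
  ... | inj₂ m≤n = subst (_≤ _) (sym (trans (m-n≡m⊖n m n) (⊖-≤ m≤n))) neg-≤-pos

module Numeration where

  open import Defs using (iter)
  open Arithmetic using (≤-suc⇒mono-≤)
  open import Data.Nat
  open import Data.Nat.Properties
  import Data.Nat.Tactic.RingSolver as ℕ-Solver
  open import Data.Nat.Induction using (<-rec)
  open import Data.Nat.Logarithm using (⌊log₂_⌋; ⌊log₂⌋-mono-≤; ⌊log₂[2^n]⌋≡n)
  open import Data.Product using (_×_; _,_; proj₁; proj₂)
  open import Data.Sum using (inj₁; inj₂)
  open import Relation.Binary.PropositionalEquality
  open import Relation.Nullary using (yes; no)
  open import Relation.Nullary.Negation using (contradiction)
  open import Algebra.Properties.CommutativeSemigroup +-commutativeSemigroup using (interchange)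

  -- A (5 + n) is the n-th term of 1, 2, 3, 4, 5, 6, 8, …; the values below index 5
  -- extend the recursion backwards.
  A : ℕ → ℕ
  A 0 = 0
  A 1 = 1
  A 2 = 1
  A 3 = 1
  A 4 = 1
  A (suc (suc (suc (suc (suc n))))) = A (suc (suc (suc (suc n)))) + A n

  A-≤-suc : ∀ n → A n ≤ A (suc n)
  A-≤-suc 0 = z≤n
  A-≤-suc 1 = ≤-refl
  A-≤-suc 2 = ≤-refl
  A-≤-suc 3 = ≤-refl
  A-≤-suc (suc (suc (suc (suc n)))) = m≤m+n (A (4 + n)) (A n)

  A-mono-≤ : ∀ {m n} → m ≤ n → A m ≤ A n
  A-mono-≤ = ≤-suc⇒mono-≤ A A-≤-suc

  2^n≤A[5n+5] : ∀ n → 2 ^ n ≤ A (5 * n + 5)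
  2^n≤A[5n+5] zero    = ≤-refl
  2^n≤A[5n+5] (suc n) = begin
    2 ^ suc n                      ≡⟨ cong (2 ^ n +_) (+-identityʳ (2 ^ n)) ⟩
    2 ^ n + 2 ^ n                  ≤⟨ +-mono-≤ (2^n≤A[5n+5] n) (2^n≤A[5n+5] n) ⟩
    A (5 * n + 5) + A (5 * n + 5)  ≤⟨ +-monoˡ-≤ _ (A-mono-≤ (m≤n+m (5 * n + 5) 4)) ⟩
    A (5 + (5 * n + 5))            ≡⟨ cong (λ m → A (m + 5)) (*-suc 5 n) ⟨
    A (5 * suc n + 5)              ∎
    where open ≤-Reasoning

  7[5[1+n]+5]≤105n : ∀ {n} → 1 ≤ n → 7 * (5 * suc n + 5) ≤ 105 * n
  7[5[1+n]+5]≤105n {n} 1≤n = begin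
    7 * (5 * suc n + 5)  ≡⟨ expand n ⟩
    35 * n + 70 * 1      ≤⟨ +-monoʳ-≤ (35 * n) (*-monoʳ-≤ 70 1≤n) ⟩
    35 * n + 70 * n      ≡⟨ *-distribʳ-+ n 35 70 ⟨
    105 * n              ∎
    where
    open ≤-Reasoning
    expand : ∀ n → 7 * (5 * suc n + 5) ≡ 35 * n + 70 * 1
    expand = ℕ-Solver.solve-∀

  n<2^[1+⌊log₂n⌋] : ∀ n → n < 2 ^ suc ⌊log₂ n ⌋
  n<2^[1+⌊log₂n⌋] n with n <? 2 ^ suc ⌊log₂ n ⌋
  ... | yes n<2^[1+L] = n<2^[1+L]
  ... | no  n≮2^[1+L] = contradiction
    (subst (_≤ ⌊log₂ n ⌋) (⌊log₂[2^n]⌋≡n (suc ⌊log₂ n ⌋)) (⌊log₂⌋-mono-≤ (≮⇒≥ n≮2^[1+L])))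
    (<-irrefl refl)

  iter-fixed : ∀ (f : ℕ → ℕ) {a} → f a ≡ a → ∀ j → iter f j a ≡ a
  iter-fixed f fa≡a zero    = refl
  iter-fixed f fa≡a (suc j) = trans (cong f (iter-fixed f fa≡a j)) fa≡a

  SmallStep : (ℕ → ℕ) → ℕ → Set
  SmallStep f n = f n ≤ f (suc n) × f (suc n) ≤ suc (f n)

  complement-smallStep : ∀ {x y g g′ c} → x + g ≡ c → y + g′ ≡ suc c →
                         g ≤ g′ → g′ ≤ suc g → x ≤ y × y ≤ suc x
  complement-smallStep {x} {y} {g} {g′} {c} x+g≡c y+g′≡1+c g≤g′ g′≤1+g =
    +-cancelʳ-≤ (suc g) x y (begin
      x + suc g  ≡⟨ trans (+-suc x g) (cong suc x+g≡c) ⟩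
      suc c      ≡⟨ y+g′≡1+c ⟨
      y + g′     ≤⟨ +-monoʳ-≤ y g′≤1+g ⟩
      y + suc g  ∎) ,
    +-cancelʳ-≤ g y (suc x) (begin
      y + g      ≤⟨ +-monoʳ-≤ y g≤g′ ⟩
      y + g′     ≡⟨ y+g′≡1+c ⟩
      suc c      ≡⟨ cong suc x+g≡c ⟨
      suc x + g  ∎)
    where open ≤-Reasoning

  module NestedRecursion (k : ℕ) (F : ℕ → ℕ) (F0 : F 0 ≡ 0)
                         (F-suc : ∀ n → F (suc n) + iter F k n ≡ suc n) where

    F≤id : ∀ n → F n ≤ n
    F≤id zero    = ≤-reflexive F0
    F≤id (suc n) = m+n≤o⇒m≤o (F (suc n)) (≤-reflexive (F-suc n))

    iter-F≤id : ∀ j n → iter F j n ≤ n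
    iter-F≤id zero    n = ≤-refl
    iter-F≤id (suc j) n = ≤-trans (F≤id _) (iter-F≤id j n)

    iter-smallStep : ∀ {n} → (∀ {a} → a ≤ n → SmallStep F a) → ∀ j → SmallStep (iter F j) n
    iter-smallStep         steps zero    = n≤1+n _ , ≤-refl
    iter-smallStep {n = n} steps (suc j) =
      F-close (proj₁ (iter-smallStep steps j)) (proj₂ (iter-smallStep steps j)) (iter-F≤id j n)
      where
      F-close : ∀ {a b} → a ≤ b → b ≤ suc a → a ≤ n → F a ≤ F b × F b ≤ suc (F a)
      F-close a≤b b≤1+a a≤n with m≤n⇒m<n∨m≡n b≤1+a
      ... | inj₁ b<1+a rewrite ≤-antisym a≤b (≤-pred b<1+a) = ≤-refl , n≤1+n _
      ... | inj₂ refl = steps a≤n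

    -- By strong induction: F n is the complement of F^k (n - 1), whose small steps
    -- only involve F below n.
    F-smallStep : ∀ n → SmallStep F n
    F-smallStep = <-rec (SmallStep F) step
      where
      step : ∀ n → (∀ {m} → m < n → SmallStep F m) → SmallStep F n
      step zero    _ rewrite F0 = z≤n , F≤id 1
      step (suc m) below = complement-smallStep (F-suc m) (F-suc (suc m)) (proj₁ G-step) (proj₂ G-step)
        where G-step = iter-smallStep (λ a≤m → below (s≤s a≤m)) k

    F-mono-≤ : ∀ {m n} → m ≤ n → F m ≤ F n
    F-mono-≤ = ≤-suc⇒mono-≤ F (λ n → proj₁ (F-smallStep n))

    F-from-iter : ∀ {n v} → iter F k n ≡ v → F (suc n) ≡ suc n ∸ v
    F-from-iter {n} refl = trans (sym (m+n∸n≡m (F (suc n)) (iter F k n))) (cong (_∸ iter F k n) (F-suc n))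

    F-shift-from-iter : ∀ a b c r → a ≡ b + c → iter F k (a + r) ≡ c + iter F k r →
                        F (a + suc r) ≡ b + F (suc r)
    F-shift-from-iter a b c r a≡b+c iter-shift = +-cancelʳ-≡ (iter F k (a + r)) _ _ (begin
      F (a + suc r) + iter F k (a + r)    ≡⟨ cong (λ m → F m + iter F k (a + r)) (+-suc a r) ⟩
      F (suc (a + r)) + iter F k (a + r)  ≡⟨ F-suc (a + r) ⟩
      suc (a + r)                         ≡⟨ +-suc a r ⟨
      a + suc r                           ≡⟨ cong₂ _+_ a≡b+c (sym (F-suc r)) ⟩
      (b + c) + (F (suc r) + iter F k r)  ≡⟨ interchange b c (F (suc r)) (iter F k r) ⟩
      (b + F (suc r)) + (c + iter F k r)  ≡⟨ cong (b + F (suc r) +_) iter-shift ⟨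
      (b + F (suc r)) + iter F k (a + r)  ∎)
      where open ≡-Reasoning

  module F₅ (F : ℕ → ℕ) (F0 : F 0 ≡ 0) (F-suc : ∀ n → F (suc n) + iter F 5 n ≡ suc n) where

    open NestedRecursion 5 F F0 F-suc

    F1≡1 : F 1 ≡ 1
    F1≡1 = F-from-iter (iter-fixed F F0 5)

    F2≡1 : F 2 ≡ 1
    F2≡1 = F-from-iter (iter-fixed F F1≡1 5)

    F3≡2 : F 3 ≡ 2
    F3≡2 = F-from-iter (trans (cong (iter F 4) F2≡1) (iter-fixed F F1≡1 4))

    F4≡3 : F 4 ≡ 3
    F4≡3 = F-from-iter (trans (cong (iter F 4) F3≡2) (trans (cong (iter F 3) F2≡1) (iter-fixed F F1≡1 3)))

    F5≡4 : F 5 ≡ 4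
    F5≡4 = F-from-iter (trans (cong (iter F 4) F4≡3) (trans (cong (iter F 3) F3≡2)
                       (trans (cong (iter F 2) F2≡1) (iter-fixed F F1≡1 2))))

    F6≡5 : F 6 ≡ 5
    F6≡5 = F-from-iter (trans (cong (iter F 4) F5≡4) (trans (cong (iter F 3) F4≡3)
                       (trans (cong (iter F 2) F3≡2) (trans (cong F F2≡1) F1≡1))))

    DigitShift : ℕ → Set
    DigitShift k = ∀ r → r ≤ A (2 + k) → F (A (6 + k) + r) ≡ A (5 + k) + F r

    F-A≡A : ∀ {k} → DigitShift k → F (A (6 + k)) ≡ A (5 + k)
    F-A≡A {k} shift = begin
      F (A (6 + k))      ≡⟨ cong F (+-identityʳ _) ⟨
      F (A (6 + k) + 0)  ≡⟨ shift 0 z≤n ⟩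
      A (5 + k) + F 0    ≡⟨ cong (A (5 + k) +_) F0 ⟩
      A (5 + k) + 0      ≡⟨ +-identityʳ _ ⟩
      A (5 + k)          ∎
      where open ≡-Reasoning

    module _ {k : ℕ} (shifts : ∀ {i} → i < k → DigitShift i) where

      F-A≡A-below : ∀ j → j < 4 + k → F (A (2 + j)) ≡ A (1 + j)
      F-A≡A-below 0 _ = F1≡1
      F-A≡A-below 1 _ = F1≡1
      F-A≡A-below 2 _ = F1≡1
      F-A≡A-below 3 _ = F1≡1
      F-A≡A-below (suc (suc (suc (suc i)))) (s≤s (s≤s (s≤s (s≤s i<k)))) = F-A≡A {i} (shifts i<k)

      F-A-bound-below : ∀ j {m} → j < 4 + k → m ≤ A (2 + j) → F m ≤ A (1 + j)
      F-A-bound-below j j<4+k m≤A = ≤-trans (F-mono-≤ m≤A) (≤-reflexive (F-A≡A-below j j<4+k))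

    digitShift-from-below : ∀ k → (∀ {i} → i < 4 + k → DigitShift i) → DigitShift (4 + k)
    digitShift-from-below k shifts = shift
      where
      shift₀ : DigitShift k
      shift₀ = shifts (s≤s (m≤n+m k 3))
      shift₁ : DigitShift (1 + k)
      shift₁ = shifts (s≤s (s≤s (m≤n+m k 2)))
      shift₂ : DigitShift (2 + k)
      shift₂ = shifts (s≤s (s≤s (s≤s (m≤n+m k 1))))
      shift₃ : DigitShift (3 + k)
      shift₃ = shifts ≤-refl

      bound : ∀ j {m} → j ≤ 4 → m ≤ A (2 + (j + k)) → F m ≤ A (1 + (j + k))
      bound j j≤4 = F-A-bound-below shifts (j + k) (s≤s (+-monoˡ-≤ k (≤-trans j≤4 (m≤m+n 4 3))))

      -- For r = 0, A (10 + k) = A (9 + k) + A (5 + k) is the top case of the previous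
      -- place; for r > 0 the defining equation reduces to F⁵ (A (10 + k) + (r - 1)),
      -- and the five applications of F lower five places one after another.
      shift : DigitShift (4 + k)
      shift zero _ = begin
        F (A (10 + k) + 0)         ≡⟨ cong F (+-identityʳ _) ⟩
        F (A (9 + k) + A (5 + k))  ≡⟨ shift₃ (A (5 + k)) ≤-refl ⟩
        A (8 + k) + F (A (5 + k))  ≡⟨ cong (A (8 + k) +_) (F-A≡A-below shifts (3 + k) (s≤s (m≤n+m (3 + k) 4))) ⟩
        A (9 + k)                  ≡⟨ +-identityʳ _ ⟨
        A (9 + k) + 0              ≡⟨ cong (A (9 + k) +_) F0 ⟨
        A (9 + k) + F 0            ∎
        where open ≡-Reasoning
      shift (suc r) 1+r≤A = F-shift-from-iter (A (10 + k)) (A (9 + k)) (A (5 + k)) r refl (begin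
        iter F 4 (F (A (10 + k) + r))          ≡⟨ cong (iter F 4) (shift r r≤A) ⟩
        iter F 3 (F (A (9 + k) + F r))         ≡⟨ cong (iter F 3) (shift₃ (F r) b₁) ⟩
        iter F 2 (F (A (8 + k) + iter F 2 r))  ≡⟨ cong (iter F 2) (shift₂ (iter F 2 r) b₂) ⟩
        F (F (A (7 + k) + iter F 3 r))         ≡⟨ cong F (shift₁ (iter F 3 r) b₃) ⟩
        F (A (6 + k) + iter F 4 r)             ≡⟨ shift₀ (iter F 4 r) b₄ ⟩
        A (5 + k) + iter F 5 r                 ∎)
        where
        open ≡-Reasoning
        r≤A = ≤-trans (n≤1+n r) 1+r≤A
        b₁ = bound 4 ≤-refl r≤A
        b₂ = bound 3 (n≤1+n 3) b₁
        b₃ = bound 2 (m≤m+n 2 2) b₂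
        b₄ = bound 1 (m≤m+n 1 3) b₃

    digitShift-step : ∀ k → (∀ {i} → i < k → DigitShift i) → DigitShift k
    digitShift-step 0 _ 0 _ = trans F2≡1 (cong (1 +_) (sym F0))
    digitShift-step 0 _ 1 _ = trans F3≡2 (cong (1 +_) (sym F1≡1))
    digitShift-step 1 _ 0 _ = trans F3≡2 (cong (2 +_) (sym F0))
    digitShift-step 1 _ 1 _ = trans F4≡3 (cong (2 +_) (sym F1≡1))
    digitShift-step 2 _ 0 _ = trans F4≡3 (cong (3 +_) (sym F0))
    digitShift-step 2 _ 1 _ = trans F5≡4 (cong (3 +_) (sym F1≡1))
    digitShift-step 3 _ 0 _ = trans F5≡4 (cong (4 +_) (sym F0))
    digitShift-step 3 _ 1 _ = trans F6≡5 (cong (4 +_) (sym F1≡1))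
    digitShift-step 0 _ (suc (suc _)) (s≤s ())
    digitShift-step 1 _ (suc (suc _)) (s≤s ())
    digitShift-step 2 _ (suc (suc _)) (s≤s ())
    digitShift-step 3 _ (suc (suc _)) (s≤s ())
    digitShift-step (suc (suc (suc (suc k)))) shifts = digitShift-from-below k shifts

    digitShift : ∀ k → DigitShift k
    digitShift = <-rec DigitShift digitShift-step

    F-leading-digit : ∀ k r → r < A (1 + k) → F (A (5 + k) + r) ≡ A (4 + k) + F r
    F-leading-digit zero    zero    _         = trans F1≡1 (cong (1 +_) (sym F0))
    F-leading-digit zero    (suc r) (s≤s ())
    F-leading-digit (suc k) r       r<A       = digitShift k r (<⇒≤ r<A)

module CubicForm where

  open import Data.Nat
  open import Data.Nat.Properties
  import Data.Nat.Tactic.RingSolver as ℕ-Solver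
  open import Data.Product using (Σ; _×_; _,_)
  open import Relation.Binary.PropositionalEquality
  open import Relation.Nullary using (Dec; yes; no; ¬_)
  open import Relation.Nullary.Negation using (contradiction)

  -- For reals, cubic x d ≤ d³ iff x ≤ α₅ d.
  cubic : ℕ → ℕ → ℕ
  cubic x d = x * x * x + x * x * d

  cubic-monoˡ-≤ : ∀ {a b} c → a ≤ b → cubic a c ≤ cubic b c
  cubic-monoˡ-≤ c a≤b = +-mono-≤ (*-mono-≤ (*-mono-≤ a≤b a≤b) a≤b) (*-monoˡ-≤ c (*-mono-≤ a≤b a≤b))

  cubic-homogeneous : ∀ k x d → cubic (k * x) (k * d) ≡ k * k * k * cubic x d
  cubic-homogeneous = identity
    where
    identity : ∀ k x d → (k * x) * (k * x) * (k * x) + (k * x) * (k * x) * (k * d)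
                         ≡ k * k * k * (x * x * x + x * x * d)
    identity = ℕ-Solver.solve-∀

  below-root-downward : ∀ {a n x d} .{{_ : NonZero d}} → d * a ≤ x * n →
                        cubic x d ≤ d * d * d → cubic a n ≤ n * n * n
  below-root-downward {a} {n} {x} {d} da≤xn x≤αd = *-cancelˡ-≤ (d * d * d) {{d³≢0}} (begin
    d * d * d * cubic a n    ≡⟨ cubic-homogeneous d a n ⟨
    cubic (d * a) (d * n)    ≤⟨ cubic-monoˡ-≤ (d * n) da≤xn ⟩
    cubic (x * n) (d * n)    ≡⟨ cong₂ cubic (*-comm x n) (*-comm d n) ⟩
    cubic (n * x) (n * d)    ≡⟨ cubic-homogeneous n x d ⟩
    n * n * n * cubic x d    ≤⟨ *-monoʳ-≤ (n * n * n) x≤αd ⟩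
    n * n * n * (d * d * d)  ≡⟨ *-comm (n * n * n) (d * d * d) ⟩
    d * d * d * (n * n * n)  ∎)
    where
    open ≤-Reasoning
    d³≢0 = m*n≢0 (d * d) d {{m*n≢0 d d}}

  above-root-upward : ∀ {b n x d} .{{_ : NonZero n}} → x * n ≤ d * b →
                      d * d * d < cubic x d → n * n * n < cubic b n
  above-root-upward {b} {n} {x} {d} xn≤db αd<x = *-cancelˡ-< (d * d * d) _ _ (begin-strict
    d * d * d * (n * n * n)  ≡⟨ *-comm (d * d * d) (n * n * n) ⟩
    n * n * n * (d * d * d)  <⟨ *-monoʳ-< (n * n * n) {{n³≢0}} αd<x ⟩
    n * n * n * cubic x d    ≡⟨ cubic-homogeneous n x d ⟨
    cubic (n * x) (n * d)    ≡⟨ cong₂ cubic (*-comm n x) (*-comm n d) ⟩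
    cubic (x * n) (d * n)    ≤⟨ cubic-monoˡ-≤ (d * n) xn≤db ⟩
    cubic (d * b) (d * n)    ≡⟨ cubic-homogeneous d b n ⟩
    d * d * d * cubic b n    ∎)
    where
    open ≤-Reasoning
    n³≢0 = m*n≢0 (n * n) n {{m*n≢0 n n}}

  crossing : ∀ {P : ℕ → Set} → (∀ x → Dec (P x)) → P 0 →
             ∀ k → ¬ P k → Σ ℕ λ x → P x × ¬ P (suc x)
  crossing P? p₀ zero    ¬pₖ = contradiction p₀ ¬pₖ
  crossing P? p₀ (suc k) ¬pₖ₊₁ with P? k
  ... | yes pₖ = k , pₖ , ¬pₖ₊₁
  ... | no ¬pₖ = crossing P? p₀ k ¬pₖ

  root-bracket : ∀ d .{{_ : NonZero d}} → Σ ℕ λ x → cubic x d ≤ d * d * d × d * d * d < cubic (suc x) d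
  root-bracket d with crossing (λ x → cubic x d ≤? d * d * d) z≤n d
    (<⇒≱ (m<m+n (d * d * d) (>-nonZero⁻¹ (d * d * d) {{m*n≢0 (d * d) d {{m*n≢0 d d}}}})))
  ... | x , x≤αd , 1+x≰αd = x , x≤αd , ≰⇒> 1+x≰αd

  -- 3 / 4 < α₅ < 7 / 9 (cubic 3 4 < 4³ and cubic 7 9 > 9³); d ≥ 45 absorbs the rounding.
  module RootBracket (d x : ℕ) (45≤d : 45 ≤ d)
    (x≤αd : cubic x d ≤ d * d * d) (αd<1+x : d * d * d < cubic (suc x) d) where

    instance
      d≢0 : NonZero d
      d≢0 = >-nonZero (≤-trans (s≤s z≤n) 45≤d)

    9x≤7d : 9 * x ≤ 7 * d
    9x≤7d with 9 * x ≤? 7 * d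
    ... | yes 9x≤7d = 9x≤7d
    ... | no  9x≰7d = contradiction (below-root-downward {7} {9} {x} {d} d7≤x9 x≤αd) (<⇒≱ (m≤m+n 730 54))
      where d7≤x9 = ≤-trans (≤-reflexive (*-comm d 7)) (≤-trans (<⇒≤ (≰⇒> 9x≰7d)) (≤-reflexive (*-comm 9 x)))

    3d<4[1+x] : 3 * d < 4 * suc x
    3d<4[1+x] with 4 * suc x ≤? 3 * d
    ... | no  4[1+x]≰3d = ≰⇒> 4[1+x]≰3d
    ... | yes 4[1+x]≤3d = contradiction (above-root-upward {3} {4} {suc x} {d} x4≤d3 αd<1+x) (<⇒≱ (m≤m+n 64 1))
      where x4≤d3 = ≤-trans (≤-reflexive (*-comm (suc x) 4)) (≤-trans 4[1+x]≤3d (≤-reflexive (*-comm 3 d)))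

    7d≤10x : 7 * d ≤ 10 * x
    7d≤10x = *-cancelˡ-≤ 4 (+-cancelʳ-≤ 40 _ _ (begin
      4 * (7 * d) + 40     ≤⟨ +-monoʳ-≤ (4 * (7 * d)) (≤-trans (m≤m+n 40 50) (*-monoʳ-≤ 2 45≤d)) ⟩
      4 * (7 * d) + 2 * d  ≡⟨ regroup d ⟩
      10 * (3 * d)         ≤⟨ *-monoʳ-≤ 10 (<⇒≤ 3d<4[1+x]) ⟩
      10 * (4 * suc x)     ≡⟨ regroup′ x ⟩
      4 * (10 * x) + 40    ∎))
      where
      open ≤-Reasoning
      regroup : ∀ d → 4 * (7 * d) + 2 * d ≡ 10 * (3 * d)
      regroup = ℕ-Solver.solve-∀
      regroup′ : ∀ x → 10 * (4 * suc x) ≡ 4 * (10 * x) + 40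
      regroup′ = ℕ-Solver.solve-∀

    5[1+x]≤4d : 5 * suc x ≤ 4 * d
    5[1+x]≤4d = *-cancelˡ-≤ 9 (begin
      9 * (5 * suc x)   ≡⟨ regroup x ⟩
      5 * (9 * x) + 45  ≤⟨ +-mono-≤ (*-monoʳ-≤ 5 9x≤7d) 45≤d ⟩
      5 * (7 * d) + d   ≡⟨ regroup′ d ⟩
      9 * (4 * d)       ∎)
      where
      open ≤-Reasoning
      regroup : ∀ x → 9 * (5 * suc x) ≡ 5 * (9 * x) + 45
      regroup = ℕ-Solver.solve-∀
      regroup′ : ∀ d → 5 * (7 * d) + d ≡ 9 * (4 * d)
      regroup′ = ℕ-Solver.solve-∀

    5x≤4d : 5 * x ≤ 4 * d
    5x≤4d = ≤-trans (*-monoʳ-≤ 5 (n≤1+n x)) 5[1+x]≤4d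

    7d≤10[1+x] : 7 * d ≤ 10 * suc x
    7d≤10[1+x] = ≤-trans 7d≤10x (*-monoʳ-≤ 10 (n≤1+n x))

    1+x≤d : suc x ≤ d
    1+x≤d = *-cancelˡ-≤ 5 (≤-trans 5[1+x]≤4d (*-monoˡ-≤ d (n≤1+n 4)))

    cubic-gap : cubic (suc x) d ≤ cubic x d + 5 * (d * d)
    cubic-gap = begin
      cubic (suc x) d                                      ≤⟨ m≤m+n _ (3 * x + 2 + d) ⟩
      cubic (suc x) d + (3 * x + 2 + d)                    ≡⟨ expand x d ⟩
      cubic x d + (3 * (suc x * suc x) + 2 * (suc x * d))
        ≤⟨ +-monoʳ-≤ (cubic x d) (+-mono-≤ (*-monoʳ-≤ 3 (*-mono-≤ 1+x≤d 1+x≤d)) (*-monoʳ-≤ 2 (*-monoˡ-≤ d 1+x≤d))) ⟩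
      cubic x d + (3 * (d * d) + 2 * (d * d))  ≡⟨ cong (cubic x d +_) (*-distribʳ-+ (d * d) 3 2) ⟨
      cubic x d + 5 * (d * d)                  ∎
      where
      open ≤-Reasoning
      expand : ∀ x d → suc x * suc x * suc x + suc x * suc x * d + (3 * x + 2 + d)
                       ≡ (x * x * x + x * x * d) + (3 * (suc x * suc x) + 2 * (suc x * d))
      expand = ℕ-Solver.solve-∀

    ∣cubic[x]-d³∣≤5d² : ∣ cubic x d - d * d * d ∣ ≤ 5 * (d * d)
    ∣cubic[x]-d³∣≤5d² = begin
      ∣ cubic x d - d * d * d ∣    ≡⟨ m≤n⇒∣m-n∣≡n∸m x≤αd ⟩
      d * d * d ∸ cubic x d        ≤⟨ ∸-monoˡ-≤ (cubic x d) (<⇒≤ αd<1+x) ⟩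
      cubic (suc x) d ∸ cubic x d  ≤⟨ m≤n+o⇒m∸n≤o _ (cubic x d) cubic-gap ⟩
      5 * (d * d)                  ∎
      where open ≤-Reasoning

    ∣cubic[1+x]-d³∣≤5d² : ∣ cubic (suc x) d - d * d * d ∣ ≤ 5 * (d * d)
    ∣cubic[1+x]-d³∣≤5d² = begin
      ∣ cubic (suc x) d - d * d * d ∣  ≡⟨ m≤n⇒∣n-m∣≡n∸m (<⇒≤ αd<1+x) ⟩
      cubic (suc x) d ∸ d * d * d      ≤⟨ ∸-monoʳ-≤ (cubic (suc x) d) x≤αd ⟩
      cubic (suc x) d ∸ cubic x d      ≤⟨ m≤n+o⇒m∸n≤o _ (cubic x d) cubic-gap ⟩
      5 * (d * d)                      ∎
      where open ≤-Reasoning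

module PadovanSplitting where

  open import Data.Nat as ℕ using (ℕ; suc; z≤n; s≤s)
  import Data.Nat.Properties as ℕ
  open import Data.Integer hiding (suc)
  open import Data.Integer.Properties
  open import Data.Integer.Tactic.RingSolver using (solve-∀)
  open import Relation.Binary.PropositionalEquality
  open Numeration using (A)
  open Arithmetic using (≤-suc⇒mono-≤)

  P : ℕ → ℕ
  P 0 = 0
  P 1 = 1
  P 2 = 1
  P (suc (suc (suc m))) = P (suc m) ℕ.+ P m

  P-≤-suc : ∀ m → P m ℕ.≤ P (suc m)
  P-≤-suc 0 = z≤n
  P-≤-suc 1 = ℕ.≤-refl
  P-≤-suc 2 = s≤s z≤n
  P-≤-suc (suc (suc (suc m))) = ℕ.+-mono-≤ (P-≤-suc (suc m)) (P-≤-suc m)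

  P-mono-≤ : ∀ {m n} → m ℕ.≤ n → P m ℕ.≤ P n
  P-mono-≤ = ≤-suc⇒mono-≤ P P-≤-suc

  -- The factors of X⁵ - X⁴ - 1 = (X³ - X - 1) (X² - X + 1) split A into P and R.
  R : ℕ → ℤ
  R m = + A (3 ℕ.+ m) - + A (1 ℕ.+ m) - + A m

  P≡A-combination : ∀ m → + P m ≡ + A (2 ℕ.+ m) - + A (1 ℕ.+ m) + + A m
  P≡A-combination 0 = refl
  P≡A-combination 1 = refl
  P≡A-combination 2 = refl
  P≡A-combination (suc (suc (suc m))) = begin
    + (P (1 ℕ.+ m) ℕ.+ P m)                        ≡⟨ pos-+ (P (1 ℕ.+ m)) (P m) ⟩
    + P (1 ℕ.+ m) + + P m                          ≡⟨ cong₂ _+_ (P≡A-combination (suc m)) (P≡A-combination m) ⟩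
    (a₃ - a₂ + a₁) + (a₂ - a₁ + a₀)                ≡⟨ telescope a₀ a₁ a₂ a₃ a₄ ⟩
    (a₄ + a₀) - a₄ + a₃                            ≡⟨ cong (λ a → a - a₄ + a₃) (sym (pos-+ (A (4 ℕ.+ m)) (A m))) ⟩
    + A (5 ℕ.+ m) - + A (4 ℕ.+ m) + + A (3 ℕ.+ m)  ∎
    where
    open ≡-Reasoning
    a₀ = + A m; a₁ = + A (1 ℕ.+ m); a₂ = + A (2 ℕ.+ m); a₃ = + A (3 ℕ.+ m); a₄ = + A (4 ℕ.+ m)
    telescope : ∀ a₀ a₁ a₂ a₃ a₄ → (a₃ - a₂ + a₁) + (a₂ - a₁ + a₀) ≡ (a₄ + a₀) - a₄ + a₃
    telescope = solve-∀

  R-antiperiodic : ∀ m → R (3 ℕ.+ m) ≡ - R m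
  R-antiperiodic m = begin
    + A (6 ℕ.+ m) - a₄ - a₃       ≡⟨ cong (λ a → a - a₄ - a₃) (pos-+ (A (5 ℕ.+ m)) (A (1 ℕ.+ m))) ⟩
    + A (5 ℕ.+ m) + a₁ - a₄ - a₃  ≡⟨ cong (λ a → a + a₁ - a₄ - a₃) (pos-+ (A (4 ℕ.+ m)) (A m)) ⟩
    a₄ + a₀ + a₁ - a₄ - a₃        ≡⟨ cancel a₀ a₁ a₃ a₄ ⟩
    - (a₃ - a₁ - a₀)              ∎
    where
    open ≡-Reasoning
    a₀ = + A m; a₁ = + A (1 ℕ.+ m); a₃ = + A (3 ℕ.+ m); a₄ = + A (4 ℕ.+ m)
    cancel : ∀ a₀ a₁ a₃ a₄ → a₄ + a₀ + a₁ - a₄ - a₃ ≡ - (a₃ - a₁ - a₀)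
    cancel = solve-∀

  ∣R∣≤1 : ∀ m → ∣ R m ∣ ℕ.≤ 1
  ∣R∣≤1 0 = z≤n
  ∣R∣≤1 1 = ℕ.≤-refl
  ∣R∣≤1 2 = ℕ.≤-refl
  ∣R∣≤1 (suc (suc (suc m))) = begin
    ∣ R (3 ℕ.+ m) ∣  ≡⟨ cong ∣_∣ (R-antiperiodic m) ⟩
    ∣ - R m ∣        ≡⟨ ∣-i∣≡∣i∣ (R m) ⟩
    ∣ R m ∣          ≤⟨ ∣R∣≤1 m ⟩
    1                ∎
    where open ℕ.≤-Reasoning

  module Approximation (d z : ℕ) where

    D Z : ℤ
    D = + d
    Z = + z

    ε : (ℕ → ℤ) → ℕ → ℤ
    ε X m = D * X m - Z * X (suc m)

    εA εP εR : ℕ → ℤ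
    εA = ε (λ m → + A m)
    εP = ε (λ m → + P m)
    εR = ε R

    -- 7 is the resultant of X³ - X - 1 and X² - X + 1.
    εA-split : ∀ m → + 7 * εA m ≡
               + 4 * εP m + + 2 * εP (1 ℕ.+ m) - εP (2 ℕ.+ m) - + 3 * εR m + εR (1 ℕ.+ m)
    εA-split m = begin
      + 7 * εA m
        ≡⟨ identity D Z (+ A m) (+ A (1 ℕ.+ m)) (+ A (2 ℕ.+ m)) (+ A (3 ℕ.+ m)) (+ A (4 ℕ.+ m)) (+ A (5 ℕ.+ m)) ⟩
      + 4 * ε p m + + 2 * ε p (1 ℕ.+ m) - ε p (2 ℕ.+ m) - + 3 * εR m + εR (1 ℕ.+ m)
        ≡⟨ cong₂ (λ a b → a - b - + 3 * εR m + εR (1 ℕ.+ m))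
                 (cong₂ (λ a b → + 4 * a + + 2 * b) (εP≡εp m) (εP≡εp (1 ℕ.+ m))) (εP≡εp (2 ℕ.+ m)) ⟨
      + 4 * εP m + + 2 * εP (1 ℕ.+ m) - εP (2 ℕ.+ m) - + 3 * εR m + εR (1 ℕ.+ m) ∎
      where
      open ≡-Reasoning
      p : ℕ → ℤ
      p m = + A (2 ℕ.+ m) - + A (1 ℕ.+ m) + + A m
      εP≡εp : ∀ m → εP m ≡ ε p m
      εP≡εp m = cong₂ (λ a b → D * a - Z * b) (P≡A-combination m) (P≡A-combination (suc m))
      identity : ∀ (D Z a₀ a₁ a₂ a₃ a₄ a₅ : ℤ) →
        + 7 * (D * a₀ - Z * a₁) ≡
          + 4 * (D * (a₂ - a₁ + a₀) - Z * (a₃ - a₂ + a₁))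
        + + 2 * (D * (a₃ - a₂ + a₁) - Z * (a₄ - a₃ + a₂))
        - (D * (a₄ - a₃ + a₂) - Z * (a₅ - a₄ + a₃))
        - + 3 * (D * (a₃ - a₁ - a₀) - Z * (a₄ - a₂ - a₁))
        + (D * (a₄ - a₂ - a₁) - Z * (a₅ - a₃ - a₂))
      identity = solve-∀

module LyapunovFunction where

  open import Data.Nat as ℕ using (ℕ; zero; suc; s≤s)
  import Data.Nat.Properties as ℕ
  import Data.Nat.Tactic.RingSolver as ℕ-Solver
  open import Data.Integer hiding (suc)
  open import Data.Integer.Properties
  open import Data.Integer.Tactic.RingSolver using (solve-∀)
  open import Data.List using (_∷_; [])
  open import Relation.Binary.PropositionalEquality
  open CubicForm using (cubic)
  open Arithmetic
  open PadovanSplitting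

  -- The discriminant 4 z d³ - u² of the quadratic form below is at least d⁴ / 2
  -- when 0.7 ≤ z / d ≤ 0.8.
  discriminant-bound : ∀ {d z u} → u ≡ z ℕ.* d ℕ.+ z ℕ.* z →
    7 ℕ.* d ℕ.≤ 10 ℕ.* z → 5 ℕ.* z ℕ.≤ 4 ℕ.* d →
    d ℕ.* d ℕ.* d ℕ.* d ℕ.+ 2 ℕ.* (u ℕ.* u) ℕ.≤ 8 ℕ.* (z ℕ.* (d ℕ.* d ℕ.* d))
  discriminant-bound {d} {z} {u} refl 7d≤10z 5z≤4d = ℕ.*-cancelˡ-≤ 875 (begin
      875 ℕ.* (d ℕ.* d ℕ.* d ℕ.* d ℕ.+ 2 ℕ.* (u ℕ.* u))
        ≡⟨ ℕ-Solver.solve (d ∷ z ∷ []) ⟩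
      125 ℕ.* (d ℕ.* d ℕ.* d) ℕ.* (7 ℕ.* d) ℕ.+ 14 ℕ.* (125 ℕ.* (u ℕ.* u))
        ≤⟨ ℕ.+-mono-≤ (ℕ.*-monoʳ-≤ (125 ℕ.* (d ℕ.* d ℕ.* d)) 7d≤10z) (ℕ.*-monoʳ-≤ 14 125u²≤324zd³) ⟩
      125 ℕ.* (d ℕ.* d ℕ.* d) ℕ.* (10 ℕ.* z) ℕ.+ 14 ℕ.* (324 ℕ.* (z ℕ.* (d ℕ.* d ℕ.* d)))
        ≡⟨ ℕ-Solver.solve (d ∷ z ∷ []) ⟩
      5786 ℕ.* (z ℕ.* (d ℕ.* d ℕ.* d))
        ≤⟨ ℕ.*-monoˡ-≤ (z ℕ.* (d ℕ.* d ℕ.* d)) (ℕ.m≤m+n 5786 1214) ⟩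
      7000 ℕ.* (z ℕ.* (d ℕ.* d ℕ.* d))
        ≡⟨ ℕ-Solver.solve (d ∷ z ∷ []) ⟩
      875 ℕ.* (8 ℕ.* (z ℕ.* (d ℕ.* d ℕ.* d))) ∎)
    where
    open ℕ.≤-Reasoning
    5u≤9zd : 5 ℕ.* u ℕ.≤ 9 ℕ.* (z ℕ.* d)
    5u≤9zd = begin
      5 ℕ.* (z ℕ.* d ℕ.+ z ℕ.* z)          ≡⟨ ℕ-Solver.solve (z ∷ d ∷ []) ⟩
      5 ℕ.* (z ℕ.* d) ℕ.+ z ℕ.* (5 ℕ.* z)  ≤⟨ ℕ.+-monoʳ-≤ (5 ℕ.* (z ℕ.* d)) (ℕ.*-monoʳ-≤ z 5z≤4d) ⟩
      5 ℕ.* (z ℕ.* d) ℕ.+ z ℕ.* (4 ℕ.* d)  ≡⟨ ℕ-Solver.solve (z ∷ d ∷ []) ⟩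
      9 ℕ.* (z ℕ.* d)                      ∎
    25u≤36d² : 25 ℕ.* u ℕ.≤ 36 ℕ.* (d ℕ.* d)
    25u≤36d² = begin
      25 ℕ.* u                 ≡⟨ ℕ-Solver.solve (z ∷ d ∷ []) ⟩
      5 ℕ.* (5 ℕ.* u)          ≤⟨ ℕ.*-monoʳ-≤ 5 5u≤9zd ⟩
      5 ℕ.* (9 ℕ.* (z ℕ.* d))  ≡⟨ ℕ-Solver.solve (z ∷ d ∷ []) ⟩
      (9 ℕ.* d) ℕ.* (5 ℕ.* z)  ≤⟨ ℕ.*-monoʳ-≤ (9 ℕ.* d) 5z≤4d ⟩
      (9 ℕ.* d) ℕ.* (4 ℕ.* d)  ≡⟨ ℕ-Solver.solve (d ∷ []) ⟩
      36 ℕ.* (d ℕ.* d)         ∎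
    125u²≤324zd³ : 125 ℕ.* (u ℕ.* u) ℕ.≤ 324 ℕ.* (z ℕ.* (d ℕ.* d ℕ.* d))
    125u²≤324zd³ = begin
      125 ℕ.* (u ℕ.* u)                         ≡⟨ ℕ-Solver.solve (z ∷ d ∷ []) ⟩
      (5 ℕ.* u) ℕ.* (25 ℕ.* u)                  ≤⟨ ℕ.*-mono-≤ 5u≤9zd 25u≤36d² ⟩
      (9 ℕ.* (z ℕ.* d)) ℕ.* (36 ℕ.* (d ℕ.* d))  ≡⟨ ℕ-Solver.solve (z ∷ d ∷ []) ⟩
      324 ℕ.* (z ℕ.* (d ℕ.* d ℕ.* d))           ∎

  lyapunov-step-identity : ∀ (D Z p₀ p₁ p₂ : ℤ) →
    let U  = Z * D + Z * Z
        c  = Z * Z * Z + Z * Z * D - D * D * D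
        e₀ = D * p₀ - Z * p₁
        e₁ = D * p₁ - Z * p₂
        e₂ = D * p₂ - Z * (p₁ + p₀)
        Q  = λ e e′ → D * D * (e′ * e′) + U * (e′ * e) + Z * D * (e * e)
    in D * D * Q e₁ e₂ ≡ Z * D * Q e₀ e₁ + c * (- p₂ * (+ 2 * D * D * e₂ + U * e₁ + c * p₂))
  lyapunov-step-identity = solve-∀

  completed-square-identity : ∀ (D Z e e′ : ℤ) →
    let U = Z * D + Z * Z
        S = + 2 * D * D * e′ + U * e
    in + 4 * D * D * (D * D * (e′ * e′) + U * (e′ * e) + Z * D * (e * e))
       ≡ S * S + (+ 4 * Z * D * D * D - U * U) * (e * e)
  completed-square-identity = solve-∀

  module Lyapunov (d z M : ℕ) .{{_ : ℕ.NonZero d}}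
    (7d≤10z : 7 ℕ.* d ℕ.≤ 10 ℕ.* z) (5z≤4d : 5 ℕ.* z ℕ.≤ 4 ℕ.* d)
    (∣cubic-d³∣≤5d² : ℕ.∣ cubic z d - d ℕ.* d ℕ.* d ∣ ℕ.≤ 5 ℕ.* (d ℕ.* d))
    (d-large : 65 ℕ.* M ℕ.* (P (3 ℕ.+ M) ℕ.* P (3 ℕ.+ M)) ℕ.≤ d) where

    open Approximation d z

    d² d³ d⁴ : ℕ
    d² = d ℕ.* d
    d³ = d ℕ.* d ℕ.* d
    d⁴ = d ℕ.* d ℕ.* d ℕ.* d

    U c : ℤ
    U = Z * D + Z * Z
    c = Z * Z * Z + Z * Z * D - D * D * D

    ∣c∣≤5d² : ∣ c ∣ ℕ.≤ 5 ℕ.* d²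
    ∣c∣≤5d² = subst (ℕ._≤ 5 ℕ.* d²)
      (sym (trans (cong ∣_∣ c≡) (∣+m-+n∣≡∣m-n∣ (cubic z d) d³))) ∣cubic-d³∣≤5d²
      where
      c≡ : c ≡ + cubic z d - + d³
      c≡ = sym (cong₂ _-_ (trans (pos-+ (z ℕ.* z ℕ.* z) (z ℕ.* z ℕ.* d)) (cong₂ _+_ (pos-*³ z z z) (pos-*³ z z d)))
                          (pos-*³ d d d))

    -- For z / d = α₅ one has quadratic e e′ = d² |e′ - λ e|², λ a complex root of
    -- X³ - X - 1; as |λ|² = α₅, Q shrinks by z / d at each step.  In general the
    -- defect is c W m, with c = z³ + z² d - d³ small.
    quadratic : ℤ → ℤ → ℤ
    quadratic e e′ = D * D * (e′ * e′) + U * (e′ * e) + Z * D * (e * e)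

    Q S V W : ℕ → ℤ
    Q m = quadratic (εP m) (εP (suc m))
    S m = + 2 * D * D * εP (suc m) + U * εP m
    V m = + 2 * D * D * εP (2 ℕ.+ m) + U * εP (suc m) + c * + P (2 ℕ.+ m)
    W m = - + P (2 ℕ.+ m) * V m

    Q-step : ∀ m → D * D * Q (suc m) ≡ Z * D * Q m + c * W m
    Q-step m = subst
      (λ e₂ → D * D * quadratic (εP (suc m)) e₂ ≡
              Z * D * Q m + c * (- p₂ * (+ 2 * D * D * e₂ + U * εP (suc m) + c * p₂)))
      (cong (λ p₃ → D * p₂ - Z * p₃) (sym (pos-+ (P (suc m)) (P m))))
      (lyapunov-step-identity D Z (+ P m) (+ P (suc m)) p₂)
      where p₂ = + P (2 ℕ.+ m)

    private instance
      d²≢0 : ℕ.NonZero d²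
      d²≢0 = ℕ.m*n≢0 d d
      d⁴≢0 : ℕ.NonZero d⁴
      d⁴≢0 = ℕ.m*n≢0 d³ d {{ℕ.m*n≢0 d² d}}
      4d²≢0 : ℕ.NonZero (4 ℕ.* d ℕ.* d)
      4d²≢0 = ℕ.m*n≢0 (4 ℕ.* d) d {{ℕ.m*n≢0 4 d}}

    z≤d : z ℕ.≤ d
    z≤d = ℕ.*-cancelˡ-≤ 5 (ℕ.≤-trans 5z≤4d (ℕ.*-monoˡ-≤ d (ℕ.m≤m+n 4 1)))

    u t Δ : ℕ
    u = z ℕ.* d ℕ.+ z ℕ.* z
    t = 4 ℕ.* z ℕ.* d ℕ.* d ℕ.* d
    Δ = t ℕ.∸ u ℕ.* u

    U≡+u : U ≡ + u
    U≡+u = sym (trans (pos-+ (z ℕ.* d) (z ℕ.* z)) (cong₂ _+_ (pos-* z d) (pos-* z z)))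

    d⁴+2u²≤2t : d⁴ ℕ.+ 2 ℕ.* (u ℕ.* u) ℕ.≤ 2 ℕ.* t
    d⁴+2u²≤2t = ℕ.≤-trans (discriminant-bound {d} {z} refl 7d≤10z 5z≤4d) (ℕ.≤-reflexive (regroup z d))
      where
      regroup : ∀ z d → 8 ℕ.* (z ℕ.* (d ℕ.* d ℕ.* d)) ≡ 2 ℕ.* (4 ℕ.* z ℕ.* d ℕ.* d ℕ.* d)
      regroup = ℕ-Solver.solve-∀

    u²≤t : u ℕ.* u ℕ.≤ t
    u²≤t = ℕ.*-cancelˡ-≤ 2 (ℕ.≤-trans (ℕ.m≤n+m _ d⁴) d⁴+2u²≤2t)

    d⁴≤2Δ : d⁴ ℕ.≤ 2 ℕ.* Δ
    d⁴≤2Δ = ℕ.≤-trans (ℕ.m+n≤o⇒m≤o∸n _ d⁴+2u²≤2t) (ℕ.≤-reflexive (sym (ℕ.*-distribˡ-∸ 2 t (u ℕ.* u))))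

    discriminant≡+Δ : + 4 * Z * D * D * D - U * U ≡ + Δ
    discriminant≡+Δ = begin
      + 4 * Z * D * D * D - U * U  ≡⟨ cong₂ _-_ 4ZD³≡+t (trans (cong₂ _*_ U≡+u U≡+u) (sym (pos-* u u))) ⟩
      + t - + (u ℕ.* u)            ≡⟨ m-n≡m⊖n t (u ℕ.* u) ⟩
      t ⊖ u ℕ.* u                  ≡⟨ ⊖-≥ u²≤t ⟩
      + Δ                          ∎
      where
      open ≡-Reasoning
      4ZD³≡+t : + 4 * Z * D * D * D ≡ + t
      4ZD³≡+t = sym (trans (pos-* (4 ℕ.* z ℕ.* d ℕ.* d) d) (cong (_* D)
                    (trans (pos-* (4 ℕ.* z ℕ.* d) d) (cong (_* D) (pos-*³ 4 z d)))))

    q e s : ℕ → ℕ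
    q m = ∣ Q m ∣
    e m = ∣ εP m ∣
    s m = ∣ S m ∣

    4d²Q≡ : ∀ m → + (4 ℕ.* d ℕ.* d) * Q m ≡ + (s m ℕ.* s m ℕ.+ Δ ℕ.* (e m ℕ.* e m))
    4d²Q≡ m = begin
      + (4 ℕ.* d ℕ.* d) * Q m  ≡⟨ cong (_* Q m) (pos-*³ 4 d d) ⟩
      + 4 * D * D * Q m        ≡⟨ completed-square-identity D Z (εP m) (εP (suc m)) ⟩
      S m * S m + (+ 4 * Z * D * D * D - U * U) * (εP m * εP m)
        ≡⟨ cong₂ _+_ (i*i≡+∣i∣*∣i∣ (S m)) (cong₂ _*_ discriminant≡+Δ (i*i≡+∣i∣*∣i∣ (εP m))) ⟩
      + (s m ℕ.* s m) + + Δ * + (e m ℕ.* e m)    ≡⟨ cong (_+_ (+ (s m ℕ.* s m))) (sym (pos-* Δ _)) ⟩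
      + (s m ℕ.* s m) + + (Δ ℕ.* (e m ℕ.* e m))  ≡⟨ sym (pos-+ (s m ℕ.* s m) _) ⟩
      + (s m ℕ.* s m ℕ.+ Δ ℕ.* (e m ℕ.* e m))    ∎
      where open ≡-Reasoning

    Q≡+q : ∀ m → Q m ≡ + q m
    Q≡+q m = +k*i≡+n⇒i≡+∣i∣ (4 ℕ.* d ℕ.* d) (4d²Q≡ m)

    d⁴e²≤8d²q : ∀ m → d⁴ ℕ.* (e m ℕ.* e m) ℕ.≤ 8 ℕ.* d² ℕ.* q m
    d⁴e²≤8d²q m = begin
      d⁴ ℕ.* (e m ℕ.* e m)                         ≤⟨ ℕ.*-monoˡ-≤ (e m ℕ.* e m) d⁴≤2Δ ⟩
      2 ℕ.* Δ ℕ.* (e m ℕ.* e m)                    ≡⟨ ℕ.*-assoc 2 Δ _ ⟩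
      2 ℕ.* (Δ ℕ.* (e m ℕ.* e m))                  ≤⟨ ℕ.*-monoʳ-≤ 2 (ℕ.m≤n+m _ (s m ℕ.* s m)) ⟩
      2 ℕ.* (s m ℕ.* s m ℕ.+ Δ ℕ.* (e m ℕ.* e m))  ≡⟨ cong (2 ℕ.*_) (+-injective (trans (sym (4d²Q≡ m)) 4d²Q≡+4d²q)) ⟩
      2 ℕ.* (4 ℕ.* d ℕ.* d ℕ.* q m)                ≡⟨ regroup d (q m) ⟩
      8 ℕ.* d² ℕ.* q m                             ∎
      where
      open ℕ.≤-Reasoning
      regroup : ∀ d x → 2 ℕ.* (4 ℕ.* d ℕ.* d ℕ.* x) ≡ 8 ℕ.* (d ℕ.* d) ℕ.* x
      regroup = ℕ-Solver.solve-∀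
      4d²Q≡+4d²q : + (4 ℕ.* d ℕ.* d) * Q m ≡ + (4 ℕ.* d ℕ.* d ℕ.* q m)
      4d²Q≡+4d²q = trans (cong (+ (4 ℕ.* d ℕ.* d) *_) (Q≡+q m)) (sym (pos-* (4 ℕ.* d ℕ.* d) (q m)))

    Pmax K : ℕ
    Pmax = P (3 ℕ.+ M)
    K = 65 ℕ.* d³ ℕ.* (Pmax ℕ.* Pmax)

    ∣εP∣≤2dPmax : ∀ j → suc j ℕ.≤ 3 ℕ.+ M → e j ℕ.≤ d ℕ.* Pmax ℕ.+ d ℕ.* Pmax
    ∣εP∣≤2dPmax j j<3+M = begin
      ∣ D * + P j - Z * + P (suc j) ∣        ≤⟨ ∣i-j∣≤∣i∣+∣j∣ (D * + P j) (Z * + P (suc j)) ⟩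
      ∣ D * + P j ∣ ℕ.+ ∣ Z * + P (suc j) ∣  ≡⟨ cong₂ ℕ._+_ (abs-* D (+ P j)) (abs-* Z (+ P (suc j))) ⟩
      d ℕ.* P j ℕ.+ z ℕ.* P (suc j)          ≤⟨ ℕ.+-mono-≤ (ℕ.*-monoʳ-≤ d (P-mono-≤ (ℕ.≤-trans (ℕ.n≤1+n j) j<3+M)))
                                                             (ℕ.*-mono-≤ z≤d (P-mono-≤ j<3+M)) ⟩
      d ℕ.* Pmax ℕ.+ d ℕ.* Pmax              ∎
      where open ℕ.≤-Reasoning

    P[2+m]≤Pmax : ∀ {m} → m ℕ.≤ M → P (2 ℕ.+ m) ℕ.≤ Pmax
    P[2+m]≤Pmax m≤M = P-mono-≤ (s≤s (s≤s (ℕ.≤-trans m≤M (ℕ.n≤1+n M))))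

    ∣V∣≤13d³Pmax : ∀ m → suc m ℕ.≤ M → ∣ V m ∣ ℕ.≤ 13 ℕ.* d³ ℕ.* Pmax
    ∣V∣≤13d³Pmax m m<M = begin
      ∣ V m ∣
        ≤⟨ ℕ.≤-trans (∣i+j∣≤∣i∣+∣j∣ (+ 2 * D * D * εP (2 ℕ.+ m) + U * εP (suc m)) (c * + P (2 ℕ.+ m)))
                     (ℕ.+-monoˡ-≤ _ (∣i+j∣≤∣i∣+∣j∣ (+ 2 * D * D * εP (2 ℕ.+ m)) (U * εP (suc m)))) ⟩
      ∣ + 2 * D * D * εP (2 ℕ.+ m) ∣ ℕ.+ ∣ U * εP (suc m) ∣ ℕ.+ ∣ c * + P (2 ℕ.+ m) ∣
        ≡⟨ cong₂ (λ a b → a ℕ.+ b ℕ.+ ∣ c * + P (2 ℕ.+ m) ∣)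
             (trans (abs-* (+ 2 * D * D) (εP (2 ℕ.+ m)))
                    (cong (ℕ._* e (2 ℕ.+ m)) (trans (abs-* (+ 2 * D) D) (cong (ℕ._* d) (abs-* (+ 2) D)))))
             (trans (abs-* U (εP (suc m))) (cong (λ x → ∣ x ∣ ℕ.* e (suc m)) U≡+u)) ⟩
      2 ℕ.* d ℕ.* d ℕ.* e (2 ℕ.+ m) ℕ.+ u ℕ.* e (suc m) ℕ.+ ∣ c * + P (2 ℕ.+ m) ∣
        ≡⟨ cong (2 ℕ.* d ℕ.* d ℕ.* e (2 ℕ.+ m) ℕ.+ u ℕ.* e (suc m) ℕ.+_) (abs-* c (+ P (2 ℕ.+ m))) ⟩
      2 ℕ.* d ℕ.* d ℕ.* e (2 ℕ.+ m) ℕ.+ u ℕ.* e (suc m) ℕ.+ ∣ c ∣ ℕ.* P (2 ℕ.+ m)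
        ≤⟨ ℕ.+-mono-≤ (ℕ.+-mono-≤ (ℕ.*-monoʳ-≤ (2 ℕ.* d ℕ.* d) (∣εP∣≤2dPmax (2 ℕ.+ m) (s≤s (s≤s (s≤s m≤M)))))
                                  (ℕ.*-mono-≤ u≤2d² (∣εP∣≤2dPmax (suc m) (s≤s (s≤s (ℕ.≤-trans m≤M (ℕ.n≤1+n M)))))))
                      (ℕ.*-mono-≤ ∣c∣≤5d² (ℕ.≤-trans (P[2+m]≤Pmax m≤M) (ℕ.m≤n*m Pmax d))) ⟩
      2 ℕ.* d ℕ.* d ℕ.* (dP ℕ.+ dP) ℕ.+ (d² ℕ.+ d²) ℕ.* (dP ℕ.+ dP) ℕ.+ 5 ℕ.* d² ℕ.* dP
        ≡⟨ collect d Pmax ⟩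
      13 ℕ.* d³ ℕ.* Pmax ∎
      where
      open ℕ.≤-Reasoning
      m≤M = ℕ.≤-trans (ℕ.n≤1+n m) m<M
      dP = d ℕ.* Pmax
      u≤2d² : u ℕ.≤ d² ℕ.+ d²
      u≤2d² = ℕ.+-mono-≤ (ℕ.*-monoˡ-≤ d z≤d) (ℕ.*-mono-≤ z≤d z≤d)
      collect : ∀ d p → 2 ℕ.* d ℕ.* d ℕ.* (d ℕ.* p ℕ.+ d ℕ.* p) ℕ.+ (d ℕ.* d ℕ.+ d ℕ.* d) ℕ.* (d ℕ.* p ℕ.+ d ℕ.* p)
                        ℕ.+ 5 ℕ.* (d ℕ.* d) ℕ.* (d ℕ.* p) ≡ 13 ℕ.* (d ℕ.* d ℕ.* d) ℕ.* p
      collect = ℕ-Solver.solve-∀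

    ∣W∣≤13d³Pmax² : ∀ m → suc m ℕ.≤ M → ∣ W m ∣ ℕ.≤ 13 ℕ.* d³ ℕ.* (Pmax ℕ.* Pmax)
    ∣W∣≤13d³Pmax² m m<M = begin
      ∣ W m ∣                          ≡⟨ abs-* (- + P (2 ℕ.+ m)) (V m) ⟩
      ∣ - + P (2 ℕ.+ m) ∣ ℕ.* ∣ V m ∣  ≡⟨ cong (ℕ._* ∣ V m ∣) (∣-i∣≡∣i∣ (+ P (2 ℕ.+ m))) ⟩
      P (2 ℕ.+ m) ℕ.* ∣ V m ∣          ≤⟨ ℕ.*-mono-≤ (P[2+m]≤Pmax (ℕ.≤-trans (ℕ.n≤1+n m) m<M)) (∣V∣≤13d³Pmax m m<M) ⟩
      Pmax ℕ.* (13 ℕ.* d³ ℕ.* Pmax)    ≡⟨ regroup d Pmax ⟩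
      13 ℕ.* d³ ℕ.* (Pmax ℕ.* Pmax)    ∎
      where
      open ℕ.≤-Reasoning
      regroup : ∀ d p → p ℕ.* (13 ℕ.* (d ℕ.* d ℕ.* d) ℕ.* p) ≡ 13 ℕ.* (d ℕ.* d ℕ.* d) ℕ.* (p ℕ.* p)
      regroup = ℕ-Solver.solve-∀

    q-recurrence : ∀ m → + (d² ℕ.* q (suc m)) ≡ + (z ℕ.* d ℕ.* q m) + c * W m
    q-recurrence m = begin
      + (d² ℕ.* q (suc m))           ≡⟨ pos-*³ d d (q (suc m)) ⟩
      D * D * + q (suc m)            ≡⟨ cong (D * D *_) (Q≡+q (suc m)) ⟨
      D * D * Q (suc m)              ≡⟨ Q-step m ⟩
      Z * D * Q m + c * W m          ≡⟨ cong (λ x → Z * D * x + c * W m) (Q≡+q m) ⟩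
      Z * D * + q m + c * W m        ≡⟨ cong (_+ c * W m) (pos-*³ z d (q m)) ⟨
      + (z ℕ.* d ℕ.* q m) + c * W m  ∎
      where open ≡-Reasoning

    q-step : ∀ m → suc m ℕ.≤ M → q (suc m) ℕ.≤ q m ℕ.+ K
    q-step m m<M = ℕ.*-cancelˡ-≤ d² (begin
      d² ℕ.* q (suc m)
        ≤⟨ +m≡+n+i⇒m≤n+∣i∣ {i = c * W m} (q-recurrence m) ⟩
      z ℕ.* d ℕ.* q m ℕ.+ ∣ c * W m ∣
        ≤⟨ ℕ.+-mono-≤ (ℕ.*-monoˡ-≤ (q m) (ℕ.*-monoˡ-≤ d z≤d))
                      (ℕ.≤-trans (ℕ.≤-reflexive (abs-* c (W m))) (ℕ.*-mono-≤ ∣c∣≤5d² (∣W∣≤13d³Pmax² m m<M))) ⟩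
      d² ℕ.* q m ℕ.+ 5 ℕ.* d² ℕ.* (13 ℕ.* d³ ℕ.* (Pmax ℕ.* Pmax))
        ≡⟨ collect d (q m) Pmax ⟩
      d² ℕ.* (q m ℕ.+ K) ∎)
      where
      open ℕ.≤-Reasoning
      collect : ∀ d x p → d ℕ.* d ℕ.* x ℕ.+ 5 ℕ.* (d ℕ.* d) ℕ.* (13 ℕ.* (d ℕ.* d ℕ.* d) ℕ.* (p ℕ.* p))
                          ≡ d ℕ.* d ℕ.* (x ℕ.+ 65 ℕ.* (d ℕ.* d ℕ.* d) ℕ.* (p ℕ.* p))
      collect = ℕ-Solver.solve-∀

    w : ℕ
    w = d ℕ.∸ z

    D-Z≡+w : D - Z ≡ + w
    D-Z≡+w = trans (m-n≡m⊖n d z) (⊖-≥ z≤d)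

    q₀+uwz≡ : q 0 ℕ.+ u ℕ.* w ℕ.* z ≡ d² ℕ.* (w ℕ.* w) ℕ.+ z ℕ.* z ℕ.* z ℕ.* d
    q₀+uwz≡ = +-injective (begin
      + (q 0 ℕ.+ u ℕ.* w ℕ.* z)                       ≡⟨ pos-+ (q 0) (u ℕ.* w ℕ.* z) ⟩
      + q 0 + + (u ℕ.* w ℕ.* z)                       ≡⟨ cong₂ _+_ (Q≡+q 0) U[D-Z]Z≡+uwz ⟨
      Q 0 + U * (D - Z) * Z                           ≡⟨ identity D Z ⟩
      D * D * ((D - Z) * (D - Z)) + Z * Z * Z * D     ≡⟨ cong₂ _+_ +d²w²≡ +z³d≡ ⟨
      + (d² ℕ.* (w ℕ.* w)) + + (z ℕ.* z ℕ.* z ℕ.* d)  ≡⟨ pos-+ (d² ℕ.* (w ℕ.* w)) _ ⟨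
      + (d² ℕ.* (w ℕ.* w) ℕ.+ z ℕ.* z ℕ.* z ℕ.* d)    ∎)
      where
      U[D-Z]Z≡+uwz : U * (D - Z) * Z ≡ + (u ℕ.* w ℕ.* z)
      U[D-Z]Z≡+uwz = trans (cong₂ (λ a b → a * b * Z) U≡+u D-Z≡+w) (sym (pos-*³ u w z))
      +d²w²≡ : + (d² ℕ.* (w ℕ.* w)) ≡ D * D * ((D - Z) * (D - Z))
      +d²w²≡ = trans (pos-* d² (w ℕ.* w)) (cong₂ _*_ (pos-* d d) (trans (pos-* w w) (sym (cong₂ _*_ D-Z≡+w D-Z≡+w))))
      +z³d≡ : + (z ℕ.* z ℕ.* z ℕ.* d) ≡ Z * Z * Z * D
      +z³d≡ = trans (pos-* (z ℕ.* z ℕ.* z) d) (cong (_* D) (pos-*³ z z z))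
      open ≡-Reasoning
      identity : ∀ (D Z : ℤ) → let U = Z * D + Z * Z in
        D * D * ((D * + 1 - Z * + 1) * (D * + 1 - Z * + 1)) + U * ((D * + 1 - Z * + 1) * (D * + 0 - Z * + 1))
        + Z * D * ((D * + 0 - Z * + 1) * (D * + 0 - Z * + 1)) + U * (D - Z) * Z
        ≡ D * D * ((D - Z) * (D - Z)) + Z * Z * Z * D
      identity = solve-∀

    q₀≤2d⁴ : q 0 ℕ.≤ 2 ℕ.* d⁴
    q₀≤2d⁴ = begin
      q 0                                       ≤⟨ ℕ.m≤m+n (q 0) (u ℕ.* w ℕ.* z) ⟩
      q 0 ℕ.+ u ℕ.* w ℕ.* z                     ≡⟨ q₀+uwz≡ ⟩
      d² ℕ.* (w ℕ.* w) ℕ.+ z ℕ.* z ℕ.* z ℕ.* d  ≤⟨ ℕ.+-mono-≤ (ℕ.*-monoʳ-≤ d² (ℕ.*-mono-≤ w≤d w≤d))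
                                                                (ℕ.*-monoˡ-≤ d (ℕ.*-mono-≤ (ℕ.*-mono-≤ z≤d z≤d) z≤d)) ⟩
      d² ℕ.* d² ℕ.+ d⁴                          ≡⟨ collect d ⟩
      2 ℕ.* d⁴                                  ∎
      where
      open ℕ.≤-Reasoning
      w≤d = ℕ.m∸n≤m d z
      collect : ∀ d → d ℕ.* d ℕ.* (d ℕ.* d) ℕ.+ d ℕ.* d ℕ.* d ℕ.* d ≡ 2 ℕ.* (d ℕ.* d ℕ.* d ℕ.* d)
      collect = ℕ-Solver.solve-∀

    q≤q₀+mK : ∀ m → m ℕ.≤ M → q m ℕ.≤ q 0 ℕ.+ m ℕ.* K
    q≤q₀+mK zero    _   = ℕ.m≤m+n (q 0) 0
    q≤q₀+mK (suc m) m<M = begin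
      q (suc m)                ≤⟨ q-step m m<M ⟩
      q m ℕ.+ K                ≤⟨ ℕ.+-monoˡ-≤ K (q≤q₀+mK m (ℕ.≤-trans (ℕ.n≤1+n m) m<M)) ⟩
      q 0 ℕ.+ m ℕ.* K ℕ.+ K    ≡⟨ ℕ.+-assoc (q 0) (m ℕ.* K) K ⟩
      q 0 ℕ.+ (m ℕ.* K ℕ.+ K)  ≡⟨ cong (q 0 ℕ.+_) (ℕ.+-comm (m ℕ.* K) K) ⟩
      q 0 ℕ.+ suc m ℕ.* K      ∎
      where open ℕ.≤-Reasoning

    q≤3d⁴ : ∀ m → m ℕ.≤ M → q m ℕ.≤ 3 ℕ.* d⁴
    q≤3d⁴ m m≤M = begin
      q m                                               ≤⟨ q≤q₀+mK m m≤M ⟩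
      q 0 ℕ.+ m ℕ.* K                                   ≤⟨ ℕ.+-mono-≤ q₀≤2d⁴ (ℕ.*-monoˡ-≤ K m≤M) ⟩
      2 ℕ.* d⁴ ℕ.+ M ℕ.* K                              ≡⟨ cong (2 ℕ.* d⁴ ℕ.+_) (regroup M d³ Pmax) ⟩
      2 ℕ.* d⁴ ℕ.+ 65 ℕ.* M ℕ.* (Pmax ℕ.* Pmax) ℕ.* d³  ≤⟨ ℕ.+-monoʳ-≤ (2 ℕ.* d⁴) (ℕ.*-monoˡ-≤ d³ d-large) ⟩
      2 ℕ.* d⁴ ℕ.+ d ℕ.* d³                             ≡⟨ collect d ⟩
      3 ℕ.* d⁴                                          ∎
      where
      open ℕ.≤-Reasoning
      regroup : ∀ M t p → M ℕ.* (65 ℕ.* t ℕ.* (p ℕ.* p)) ≡ 65 ℕ.* M ℕ.* (p ℕ.* p) ℕ.* t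
      regroup = ℕ-Solver.solve-∀
      collect : ∀ d → 2 ℕ.* (d ℕ.* d ℕ.* d ℕ.* d) ℕ.+ d ℕ.* (d ℕ.* d ℕ.* d) ≡ 3 ℕ.* (d ℕ.* d ℕ.* d ℕ.* d)
      collect = ℕ-Solver.solve-∀

    ∣εP∣≤5d : ∀ m → m ℕ.≤ M → ∣ εP m ∣ ℕ.≤ 5 ℕ.* d
    ∣εP∣≤5d m m≤M = m*m≤n*n⇒m≤n (ℕ.*-cancelˡ-≤ d⁴ (begin
      d⁴ ℕ.* (e m ℕ.* e m)            ≤⟨ d⁴e²≤8d²q m ⟩
      8 ℕ.* d² ℕ.* q m                ≤⟨ ℕ.*-monoʳ-≤ (8 ℕ.* d²) (q≤3d⁴ m m≤M) ⟩
      8 ℕ.* d² ℕ.* (3 ℕ.* d⁴)         ≤⟨ ℕ.≤-reflexive (regroup d) ⟩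
      d⁴ ℕ.* (24 ℕ.* d²)              ≤⟨ ℕ.*-monoʳ-≤ d⁴ (ℕ.*-monoˡ-≤ d² (ℕ.n≤1+n 24)) ⟩
      d⁴ ℕ.* (25 ℕ.* d²)              ≡⟨ regroup′ d ⟩
      d⁴ ℕ.* (5 ℕ.* d ℕ.* (5 ℕ.* d))  ∎))
      where
      open ℕ.≤-Reasoning
      regroup : ∀ d → 8 ℕ.* (d ℕ.* d) ℕ.* (3 ℕ.* (d ℕ.* d ℕ.* d ℕ.* d)) ≡ d ℕ.* d ℕ.* d ℕ.* d ℕ.* (24 ℕ.* (d ℕ.* d))
      regroup = ℕ-Solver.solve-∀
      regroup′ : ∀ d → d ℕ.* d ℕ.* d ℕ.* d ℕ.* (25 ℕ.* (d ℕ.* d)) ≡ d ℕ.* d ℕ.* d ℕ.* d ℕ.* (5 ℕ.* d ℕ.* (5 ℕ.* d))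
      regroup′ = ℕ-Solver.solve-∀

    ∣εR∣≤2d : ∀ m → ∣ εR m ∣ ℕ.≤ d ℕ.+ d
    ∣εR∣≤2d m = begin
      ∣ D * R m - Z * R (suc m) ∣            ≤⟨ ∣i-j∣≤∣i∣+∣j∣ (D * R m) (Z * R (suc m)) ⟩
      ∣ D * R m ∣ ℕ.+ ∣ Z * R (suc m) ∣      ≡⟨ cong₂ ℕ._+_ (abs-* D (R m)) (abs-* Z (R (suc m))) ⟩
      d ℕ.* ∣ R m ∣ ℕ.+ z ℕ.* ∣ R (suc m) ∣  ≤⟨ ℕ.+-mono-≤ (ℕ.*-monoʳ-≤ d (∣R∣≤1 m))
                                                             (ℕ.*-mono-≤ z≤d (∣R∣≤1 (suc m))) ⟩
      d ℕ.* 1 ℕ.+ d ℕ.* 1                    ≡⟨ cong₂ ℕ._+_ (ℕ.*-identityʳ d) (ℕ.*-identityʳ d) ⟩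
      d ℕ.+ d                                ∎
      where open ℕ.≤-Reasoning

    ∣εA∣≤7d : ∀ m → 2 ℕ.+ m ℕ.≤ M → ∣ εA m ∣ ℕ.≤ 7 ℕ.* d
    ∣εA∣≤7d m 2+m≤M = ℕ.*-cancelˡ-≤ 7 (begin
      7 ℕ.* ∣ εA m ∣  ≡⟨ abs-* (+ 7) (εA m) ⟨
      ∣ + 7 * εA m ∣  ≡⟨ cong ∣_∣ (εA-split m) ⟩
      ∣ + 4 * εP m + + 2 * εP (1 ℕ.+ m) - εP (2 ℕ.+ m) - + 3 * εR m + εR (1 ℕ.+ m) ∣
        ≤⟨ triangle (+ 4 * εP m) (+ 2 * εP (1 ℕ.+ m)) (εP (2 ℕ.+ m)) (+ 3 * εR m) (εR (1 ℕ.+ m)) ⟩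
      ∣ + 4 * εP m ∣ ℕ.+ ∣ + 2 * εP (1 ℕ.+ m) ∣ ℕ.+ ∣ εP (2 ℕ.+ m) ∣ ℕ.+ ∣ + 3 * εR m ∣ ℕ.+ ∣ εR (1 ℕ.+ m) ∣
        ≡⟨ cong₂ (λ a b → a ℕ.+ ∣ εP (2 ℕ.+ m) ∣ ℕ.+ b ℕ.+ ∣ εR (1 ℕ.+ m) ∣)
                 (cong₂ ℕ._+_ (abs-* (+ 4) (εP m)) (abs-* (+ 2) (εP (1 ℕ.+ m)))) (abs-* (+ 3) (εR m)) ⟩
      4 ℕ.* e m ℕ.+ 2 ℕ.* e (1 ℕ.+ m) ℕ.+ e (2 ℕ.+ m) ℕ.+ 3 ℕ.* ∣ εR m ∣ ℕ.+ ∣ εR (1 ℕ.+ m) ∣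
        ≤⟨ ℕ.+-mono-≤ (ℕ.+-mono-≤ (ℕ.+-mono-≤ (ℕ.+-mono-≤
             (ℕ.*-monoʳ-≤ 4 (∣εP∣≤5d m m≤M)) (ℕ.*-monoʳ-≤ 2 (∣εP∣≤5d (1 ℕ.+ m) 1+m≤M)))
             (∣εP∣≤5d (2 ℕ.+ m) 2+m≤M)) (ℕ.*-monoʳ-≤ 3 (∣εR∣≤2d m))) (∣εR∣≤2d (1 ℕ.+ m)) ⟩
      4 ℕ.* (5 ℕ.* d) ℕ.+ 2 ℕ.* (5 ℕ.* d) ℕ.+ 5 ℕ.* d ℕ.+ 3 ℕ.* (d ℕ.+ d) ℕ.+ (d ℕ.+ d)
        ≡⟨ collect d ⟩
      43 ℕ.* d
        ≤⟨ ℕ.*-monoˡ-≤ d (ℕ.m≤m+n 43 6) ⟩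
      49 ℕ.* d
        ≡⟨ ℕ.*-assoc 7 7 d ⟩
      7 ℕ.* (7 ℕ.* d) ∎)
      where
      open ℕ.≤-Reasoning
      1+m≤M = ℕ.≤-trans (ℕ.n≤1+n (1 ℕ.+ m)) 2+m≤M
      m≤M = ℕ.≤-trans (ℕ.n≤1+n m) 1+m≤M
      collect : ∀ d → 4 ℕ.* (5 ℕ.* d) ℕ.+ 2 ℕ.* (5 ℕ.* d) ℕ.+ 5 ℕ.* d ℕ.+ 3 ℕ.* (d ℕ.+ d) ℕ.+ (d ℕ.+ d) ≡ 43 ℕ.* d
      collect = ℕ-Solver.solve-∀
      triangle : ∀ a b c x y → ∣ a + b - c - x + y ∣ ℕ.≤ ∣ a ∣ ℕ.+ ∣ b ∣ ℕ.+ ∣ c ∣ ℕ.+ ∣ x ∣ ℕ.+ ∣ y ∣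
      triangle a b c x y =
        ℕ.≤-trans (∣i+j∣≤∣i∣+∣j∣ (a + b - c - x) y) (ℕ.+-monoˡ-≤ ∣ y ∣
        (ℕ.≤-trans (∣i-j∣≤∣i∣+∣j∣ (a + b - c) x) (ℕ.+-monoˡ-≤ ∣ x ∣
        (ℕ.≤-trans (∣i-j∣≤∣i∣+∣j∣ (a + b) c) (ℕ.+-monoˡ-≤ ∣ c ∣ (∣i+j∣≤∣i∣+∣j∣ a b))))))

module QuinticForm where

  open import Defs using (≤-α₅n; α₅n-≤)
  open import Data.Nat as ℕ using (suc; z≤n)
  import Data.Nat.Properties as ℕ
  open import Data.Integer hiding (suc)
  open import Data.Integer.Properties
  open import Data.Integer.Tactic.RingSolver using (solve-∀)
  open import Data.Sum using (inj₁; inj₂)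
  open import Relation.Binary.PropositionalEquality
  open CubicForm using (cubic; cubic-monoˡ-≤)
  open Arithmetic using (pos-*³; +k*i≡+n⇒i≡+∣i∣; i*i≡+∣i∣*∣i∣)

  quintic-factorisation : ∀ (a n : ℤ) →
    a * (a * (a * (a * (a * + 1)))) + a * (n * (n * (n * (n * + 1)))) - n * (n * (n * (n * (n * + 1))))
    ≡ (a * a - a * n + n * n) * (a * a * a + a * a * n - n * n * n)
  quintic-factorisation = solve-∀

  a²-an+n²≥0 : ∀ a n → 0ℤ ≤ a * a - a * n + n * n
  a²-an+n²≥0 a n = subst (0ℤ ≤_) (sym (+k*i≡+n⇒i≡+∣i∣ 4 4f≡)) (+≤+ z≤n)
    where
    f = a * a - a * n + n * n
    s = + 2 * a - n
    completed-square : ∀ a n → + 4 * (a * a - a * n + n * n) ≡ (+ 2 * a - n) * (+ 2 * a - n) + + 3 * (n * n)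
    completed-square = solve-∀
    4f≡ : + 4 * f ≡ + (∣ s ∣ ℕ.* ∣ s ∣ ℕ.+ 3 ℕ.* (∣ n ∣ ℕ.* ∣ n ∣))
    4f≡ = begin
      + 4 * f                                            ≡⟨ completed-square a n ⟩
      s * s + + 3 * (n * n)                              ≡⟨ cong₂ (λ x y → x + + 3 * y) (i*i≡+∣i∣*∣i∣ s) (i*i≡+∣i∣*∣i∣ n) ⟩
      + (∣ s ∣ ℕ.* ∣ s ∣) + + 3 * + (∣ n ∣ ℕ.* ∣ n ∣)    ≡⟨ cong (_+_ (+ (∣ s ∣ ℕ.* ∣ s ∣))) (pos-* 3 (∣ n ∣ ℕ.* ∣ n ∣)) ⟨
      + (∣ s ∣ ℕ.* ∣ s ∣) + + (3 ℕ.* (∣ n ∣ ℕ.* ∣ n ∣))  ≡⟨ pos-+ (∣ s ∣ ℕ.* ∣ s ∣) _ ⟨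
      + (∣ s ∣ ℕ.* ∣ s ∣ ℕ.+ 3 ℕ.* (∣ n ∣ ℕ.* ∣ n ∣))    ∎
      where open ≡-Reasoning

  ≤-α₅n-from-cubic : ∀ a n → a * a * a + a * a * + n - + n * + n * + n ≤ 0ℤ → ≤-α₅n a n
  ≤-α₅n-from-cubic a n g≤0 = i-j≤0⇒i≤j (begin
    a * (a * (a * (a * (a * + 1)))) + a * (N * (N * (N * (N * + 1)))) - N * (N * (N * (N * (N * + 1))))
            ≡⟨ quintic-factorisation a N ⟩
    f * g   ≤⟨ *-monoˡ-≤-nonNeg f {{nonNegative (a²-an+n²≥0 a N)}} g≤0 ⟩
    f * 0ℤ  ≡⟨ *-zeroʳ f ⟩
    0ℤ      ∎)
    where
    open ≤-Reasoning
    N = + n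
    f = a * a - a * N + N * N
    g = a * a * a + a * a * N - N * N * N

  α₅n-≤-from-cubic : ∀ b n → 0ℤ ≤ b * b * b + b * b * + n - + n * + n * + n → α₅n-≤ n b
  α₅n-≤-from-cubic b n 0≤g = 0≤i-j⇒j≤i (begin
    0ℤ      ≡⟨ *-zeroʳ f ⟨
    f * 0ℤ  ≤⟨ *-monoˡ-≤-nonNeg f {{nonNegative (a²-an+n²≥0 b N)}} 0≤g ⟩
    f * g   ≡⟨ quintic-factorisation b N ⟨
    b * (b * (b * (b * (b * + 1)))) + b * (N * (N * (N * (N * + 1)))) - N * (N * (N * (N * (N * + 1)))) ∎)
    where
    open ≤-Reasoning
    N = + n
    f = b * b - b * N + N * N
    g = b * b * b + b * b * N - N * N * N

  cubic-cast : ∀ y n → + y * + y * + y + + y * + y * + n - + n * + n * + n ≡ + cubic y n - + (n ℕ.* n ℕ.* n)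
  cubic-cast y n = sym (cong₂ _-_ (trans (pos-+ (y ℕ.* y ℕ.* y) (y ℕ.* y ℕ.* n)) (cong₂ _+_ (pos-*³ y y y) (pos-*³ y y n)))
                                  (pos-*³ n n n))

  b²n≤b³+n³ : ∀ b n → b ℕ.* b ℕ.* n ℕ.≤ b ℕ.* b ℕ.* b ℕ.+ n ℕ.* n ℕ.* n
  b²n≤b³+n³ b n with ℕ.≤-total b n
  ... | inj₁ b≤n = ℕ.≤-trans (ℕ.*-monoˡ-≤ n (ℕ.*-mono-≤ b≤n b≤n)) (ℕ.m≤n+m _ _)
  ... | inj₂ n≤b = ℕ.≤-trans (ℕ.*-monoʳ-≤ (b ℕ.* b) n≤b) (ℕ.m≤m+n _ _)

  ≤-α₅n-downward : ∀ a {a₀ n} → a ≤ + a₀ → cubic a₀ n ℕ.≤ n ℕ.* n ℕ.* n → ≤-α₅n a n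
  ≤-α₅n-downward (+ a) {n = n} (+≤+ a≤a₀) a₀≤αn = ≤-α₅n-from-cubic (+ a) n
    (subst (_≤ 0ℤ) (sym (cubic-cast a n)) (i≤j⇒i-j≤0 (+≤+ (ℕ.≤-trans (cubic-monoˡ-≤ n a≤a₀) a₀≤αn))))
  ≤-α₅n-downward -[1+ k ] {n = n} _ _ = ≤-α₅n-from-cubic -[1+ k ] n (subst (_≤ 0ℤ) (sym (identity B N)) (i≤j⇒i-j≤0
    (subst₂ _≤_ (pos-*³ b b n) (trans (pos-+ (b ℕ.* b ℕ.* b) (n ℕ.* n ℕ.* n)) (cong₂ _+_ (pos-*³ b b b) (pos-*³ n n n)))
                (+≤+ (b²n≤b³+n³ b n)))))
    where
    b = suc k
    B = + b
    N = + n
    identity : ∀ B N → (- B) * (- B) * (- B) + (- B) * (- B) * N - N * N * N ≡ B * B * N - (B * B * B + N * N * N)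
    identity = solve-∀

  α₅n-≤-upward : ∀ {b n} → n ℕ.* n ℕ.* n ℕ.≤ cubic b n → α₅n-≤ n (+ b)
  α₅n-≤-upward {b} {n} αn≤b = α₅n-≤-from-cubic (+ b) n (subst (0ℤ ≤_) (sym (cubic-cast b n)) (i≤j⇒0≤j-i (+≤+ αn≤b)))

module Estimates where

  open import Defs using (≤-α₅n; α₅n-≤)
  open import Data.Nat as ℕ using (ℕ; zero; suc; z≤n; s≤s)
  import Data.Nat.Properties as ℕ
  import Data.Nat.Tactic.RingSolver as ℕ-Solver
  open import Data.Integer hiding (suc)
  open import Data.Integer.Properties hiding (_<?_)
  open import Data.Integer.Tactic.RingSolver using (solve-∀)
  open import Data.Product using (proj₁; proj₂)
  open import Relation.Binary.PropositionalEquality hiding (J)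
  open import Relation.Nullary using (yes; no)
  open import Relation.Nullary.Negation using (contradiction)
  open Numeration using (A; A-mono-≤)
  open CubicForm
  open Arithmetic using (∣+m-+n∣≡∣m-n∣; +m-+n≤+[m∸k]; ∣m-n∣≤o⇒m≤o+n; ∣m-n∣≤o⇒n≤o+m)
  open PadovanSplitting using (P; module Approximation)
  open LyapunovFunction using (module Lyapunov)
  open QuinticForm using (≤-α₅n-downward; α₅n-≤-upward)

  module DigitErrors (F : ℕ → ℕ) (F0 : F 0 ≡ 0)
    (F-leading-digit : ∀ k r → r ℕ.< A (1 ℕ.+ k) → F (A (5 ℕ.+ k) ℕ.+ r) ≡ A (4 ℕ.+ k) ℕ.+ F r)
    (d z : ℕ) where

    open Approximation d z using (D; Z; εA)

    -- d δ₅ n, with z / d in place of α₅.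
    εF : ℕ → ℤ
    εF n = D * + F n - Z * + n

    εF-split : ∀ k r → r ℕ.< A (1 ℕ.+ k) → εF (A (5 ℕ.+ k) ℕ.+ r) ≡ εA (4 ℕ.+ k) + εF r
    εF-split k r r<A = begin
      D * + F (A (5 ℕ.+ k) ℕ.+ r) - Z * + (A (5 ℕ.+ k) ℕ.+ r)
        ≡⟨ cong (λ f → D * + f - Z * + (A (5 ℕ.+ k) ℕ.+ r)) (F-leading-digit k r r<A) ⟩
      D * + (A (4 ℕ.+ k) ℕ.+ F r) - Z * + (A (5 ℕ.+ k) ℕ.+ r)
        ≡⟨ cong₂ (λ a b → D * a - Z * b) (pos-+ (A (4 ℕ.+ k)) (F r)) (pos-+ (A (5 ℕ.+ k)) r) ⟩
      D * (+ A (4 ℕ.+ k) + + F r) - Z * (+ A (5 ℕ.+ k) + + r)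
        ≡⟨ regroup D Z (+ A (4 ℕ.+ k)) (+ A (5 ℕ.+ k)) (+ F r) (+ r) ⟩
      εA (4 ℕ.+ k) + εF r ∎
      where
      open ≡-Reasoning
      regroup : ∀ D Z a a′ f r → D * (a + f) - Z * (a′ + r) ≡ (D * a - Z * a′) + (D * f - Z * r)
      regroup = solve-∀

    εF-zero : εF 0 ≡ 0ℤ
    εF-zero = begin
      D * + F 0 - Z * + 0  ≡⟨ cong (λ f → D * + f - Z * + 0) F0 ⟩
      D * 0ℤ - Z * 0ℤ      ≡⟨ cong₂ _-_ (*-zeroʳ D) (*-zeroʳ Z) ⟩
      0ℤ                   ∎
      where open ≡-Reasoning

    ∣εF∣-bound : ∀ {c M} → (∀ m → 2 ℕ.+ m ℕ.≤ M → ∣ εA m ∣ ℕ.≤ c) →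
                 ∀ j → j ℕ.≤ M → ∀ n → n ℕ.< A j → ∣ εF n ∣ ℕ.≤ c ℕ.* j
    ∣εF∣-bound {c} {M} εA-bound = bound
      where
      bound : ∀ j → j ℕ.≤ M → ∀ n → n ℕ.< A j → ∣ εF n ∣ ℕ.≤ c ℕ.* j
      top-digit : ∀ j → suc j ℕ.≤ M → ∀ n → A j ℕ.≤ n → n ℕ.< A (suc j) → ∣ εF n ∣ ℕ.≤ c ℕ.* suc j

      bound zero    _     n ()
      bound (suc j) 1+j≤M n n<A[1+j] with n ℕ.<? A j
      ... | yes n<A[j] = ℕ.≤-trans (bound j (ℕ.≤-trans (ℕ.n≤1+n j) 1+j≤M) n n<A[j]) (ℕ.*-monoʳ-≤ c (ℕ.n≤1+n j))
      ... | no  n≮A[j] = top-digit j 1+j≤M n (ℕ.≮⇒≥ n≮A[j]) n<A[1+j]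

      top-digit 0 _ 0       _ _        = ℕ.≤-trans (ℕ.≤-reflexive (cong ∣_∣ εF-zero)) z≤n
      top-digit 0 _ (suc n) _ (s≤s ())
      top-digit 1 _ n 1≤n n<1 = contradiction n<1 (ℕ.≤⇒≯ 1≤n)
      top-digit 2 _ n 1≤n n<1 = contradiction n<1 (ℕ.≤⇒≯ 1≤n)
      top-digit 3 _ n 1≤n n<1 = contradiction n<1 (ℕ.≤⇒≯ 1≤n)
      top-digit 4 _ n 1≤n n<1 = contradiction n<1 (ℕ.≤⇒≯ 1≤n)
      top-digit j@(suc (suc (suc (suc (suc k))))) 6+k≤M n A≤n n<A = begin
        ∣ εF n ∣                       ≡⟨ cong (λ m → ∣ εF m ∣) (ℕ.m+[n∸m]≡n A≤n) ⟨
        ∣ εF (A (5 ℕ.+ k) ℕ.+ r) ∣     ≡⟨ cong ∣_∣ (εF-split k r r<A[1+k]) ⟩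
        ∣ εA (4 ℕ.+ k) + εF r ∣        ≤⟨ ∣i+j∣≤∣i∣+∣j∣ (εA (4 ℕ.+ k)) (εF r) ⟩
        ∣ εA (4 ℕ.+ k) ∣ ℕ.+ ∣ εF r ∣  ≤⟨ ℕ.+-mono-≤ (εA-bound (4 ℕ.+ k) 6+k≤M)
                                                            (bound j (ℕ.≤-trans (ℕ.n≤1+n j) 6+k≤M) r r<A[5+k]) ⟩
        c ℕ.+ c ℕ.* (5 ℕ.+ k)  ≡⟨ ℕ.*-suc c (5 ℕ.+ k) ⟨
        c ℕ.* (6 ℕ.+ k)        ∎
        where
        open ℕ.≤-Reasoning
        r = n ℕ.∸ A (5 ℕ.+ k)
        r<A[1+k] : r ℕ.< A (1 ℕ.+ k)
        r<A[1+k] = ℕ.+-cancelˡ-< (A (5 ℕ.+ k)) r (A (1 ℕ.+ k))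
                     (subst (ℕ._< A (6 ℕ.+ k)) (sym (ℕ.m+[n∸m]≡n A≤n)) n<A)
        r<A[5+k] : r ℕ.< A (5 ℕ.+ k)
        r<A[5+k] = ℕ.<-≤-trans r<A[1+k] (A-mono-≤ (ℕ.m≤n+m (1 ℕ.+ k) 4))

  module Estimate (F : ℕ → ℕ) (F0 : F 0 ≡ 0)
    (F-leading-digit : ∀ k r → r ℕ.< A (1 ℕ.+ k) → F (A (5 ℕ.+ k) ℕ.+ r) ≡ A (4 ℕ.+ k) ℕ.+ F r)
    (J n : ℕ) (n<A[J] : n ℕ.< A J) where

    -- 45 ≤ d is needed by RootBracket, 65 J Pmax² ≤ d by Lyapunov.
    Pmax d : ℕ
    Pmax = P (3 ℕ.+ J)
    d = 45 ℕ.+ 65 ℕ.* J ℕ.* (Pmax ℕ.* Pmax)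

    x : ℕ
    x = proj₁ (root-bracket d)

    x≤αd : cubic x d ℕ.≤ d ℕ.* d ℕ.* d
    x≤αd = proj₁ (proj₂ (root-bracket d))

    αd<1+x : d ℕ.* d ℕ.* d ℕ.< cubic (suc x) d
    αd<1+x = proj₂ (proj₂ (root-bracket d))

    open RootBracket d x (ℕ.m≤m+n 45 _) x≤αd αd<1+x

    ∣dF-zn∣≤7dJ : ∀ z → 7 ℕ.* d ℕ.≤ 10 ℕ.* z → 5 ℕ.* z ℕ.≤ 4 ℕ.* d →
                   ℕ.∣ cubic z d - d ℕ.* d ℕ.* d ∣ ℕ.≤ 5 ℕ.* (d ℕ.* d) →
                   ℕ.∣ d ℕ.* F n - z ℕ.* n ∣ ℕ.≤ 7 ℕ.* d ℕ.* J
    ∣dF-zn∣≤7dJ z 7d≤10z 5z≤4d ∣cubic-d³∣≤5d² = subst (ℕ._≤ 7 ℕ.* d ℕ.* J) ∣εF∣≡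
      (∣εF∣-bound (∣εA∣≤7d) J ℕ.≤-refl n n<A[J])
      where
      open Lyapunov d z J 7d≤10z 5z≤4d ∣cubic-d³∣≤5d² (ℕ.m≤n+m _ 45) using (∣εA∣≤7d)
      open DigitErrors F F0 F-leading-digit d z using (εF; ∣εF∣-bound)
      ∣εF∣≡ : ∣ εF n ∣ ≡ ℕ.∣ d ℕ.* F n - z ℕ.* n ∣
      ∣εF∣≡ = trans (cong ∣_∣ (sym (cong₂ _-_ (pos-* d (F n)) (pos-* z n)))) (∣+m-+n∣≡∣m-n∣ (d ℕ.* F n) (z ℕ.* n))

    F∸7J-below-root : cubic (F n ℕ.∸ 7 ℕ.* J) n ℕ.≤ n ℕ.* n ℕ.* n
    F∸7J-below-root = below-root-downward {F n ℕ.∸ 7 ℕ.* J} {n} {x} {d} d[F-7J]≤xn x≤αd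
      where
      dF≤7dJ+xn : d ℕ.* F n ℕ.≤ 7 ℕ.* d ℕ.* J ℕ.+ x ℕ.* n
      dF≤7dJ+xn = ∣m-n∣≤o⇒m≤o+n (∣dF-zn∣≤7dJ x 7d≤10x 5x≤4d ∣cubic[x]-d³∣≤5d²)
      d[F-7J]≤xn : d ℕ.* (F n ℕ.∸ 7 ℕ.* J) ℕ.≤ x ℕ.* n
      d[F-7J]≤xn = begin
        d ℕ.* (F n ℕ.∸ 7 ℕ.* J)        ≡⟨ ℕ.*-distribˡ-∸ d (F n) (7 ℕ.* J) ⟩
        d ℕ.* F n ℕ.∸ d ℕ.* (7 ℕ.* J)  ≡⟨ cong (d ℕ.* F n ℕ.∸_) (regroup d J) ⟩
        d ℕ.* F n ℕ.∸ 7 ℕ.* d ℕ.* J    ≤⟨ ℕ.m≤n+o⇒m∸n≤o (d ℕ.* F n) (7 ℕ.* d ℕ.* J) dF≤7dJ+xn ⟩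
        x ℕ.* n                        ∎
        where
        open ℕ.≤-Reasoning
        regroup : ∀ d J → d ℕ.* (7 ℕ.* J) ≡ 7 ℕ.* d ℕ.* J
        regroup = ℕ-Solver.solve-∀

    F+7J-above-root : .{{_ : ℕ.NonZero n}} → n ℕ.* n ℕ.* n ℕ.< cubic (F n ℕ.+ 7 ℕ.* J) n
    F+7J-above-root = above-root-upward {F n ℕ.+ 7 ℕ.* J} {n} {suc x} {d} [1+x]n≤d[F+7J] αd<1+x
      where
      [1+x]n≤d[F+7J] : suc x ℕ.* n ℕ.≤ d ℕ.* (F n ℕ.+ 7 ℕ.* J)
      [1+x]n≤d[F+7J] = ℕ.≤-trans
        (∣m-n∣≤o⇒n≤o+m (∣dF-zn∣≤7dJ (suc x) 7d≤10[1+x] 5[1+x]≤4d ∣cubic[1+x]-d³∣≤5d²))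
        (ℕ.≤-reflexive (regroup d (F n) J))
        where
        regroup : ∀ d f J → 7 ℕ.* d ℕ.* J ℕ.+ d ℕ.* f ≡ d ℕ.* (f ℕ.+ 7 ℕ.* J)
        regroup = ℕ-Solver.solve-∀

    F-lower : ∀ {c} → 7 ℕ.* J ℕ.≤ c → ≤-α₅n (+ F n - + c) n
    F-lower {c} 7J≤c =
      ≤-α₅n-downward (+ F n - + c) {F n ℕ.∸ 7 ℕ.* J} {n} (+m-+n≤+[m∸k] 7J≤c) F∸7J-below-root

    F-upper : ∀ {c} .{{_ : ℕ.NonZero n}} → 7 ℕ.* J ℕ.≤ c → α₅n-≤ n (+ (F n ℕ.+ c))
    F-upper {c} 7J≤c = α₅n-≤-upward {F n ℕ.+ c} {n}
      (ℕ.≤-trans (ℕ.<⇒≤ F+7J-above-root) (cubic-monoˡ-≤ n (ℕ.+-monoʳ-≤ (F n) 7J≤c)))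

open import Defs
open import Data.Nat using (ℕ; _≥_)
open import Data.Nat.Logarithm using (⌊log₂_⌋)
open import Data.Integer using (+_; _-_; _+_; _*_)
open import Data.Product using (Σ; _×_)
open import Data.Product using (_,_)
import Data.Nat as ℕ
import Data.Nat.Properties as ℕ
open import Data.Nat.Logarithm using (⌊log₂⌋-mono-≤)
open import Data.Integer.Properties using (pos-+; pos-*)
open import Relation.Binary.PropositionalEquality using (trans; cong; subst)
open Numeration using (2^n≤A[5n+5]; n<2^[1+⌊log₂n⌋]; 7[5[1+n]+5]≤105n; module F₅)
open Estimates using (module Estimate)

proposition8p6 : (F : ℕ → ℕ) → IsF5 F →
    Σ ℕ (λ C → Σ ℕ (λ N → (n : ℕ) → n ≥ N →
    ≤-α₅n ((+ F n) - (+ C) * (+ ⌊log₂ n ⌋)) n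
    × α₅n-≤ n ((+ F n) + (+ C) * (+ ⌊log₂ n ⌋))))
proposition8p6 F (F0 , F-suc) = 105 , 2 , bounds
  where
  open F₅ F F0 F-suc using (F-leading-digit)
  bounds : ∀ n → n ≥ 2 → ≤-α₅n (+ F n - + 105 * + ⌊log₂ n ⌋) n × α₅n-≤ n (+ F n + + 105 * + ⌊log₂ n ⌋)
  bounds n@(ℕ.suc _) n≥2 =
      subst (λ c → ≤-α₅n (+ F n - c) n) (pos-* 105 L) (F-lower 7J≤105L)
    , subst (α₅n-≤ n) (trans (pos-+ (F n) (105 ℕ.* L)) (cong (_+_ (+ F n)) (pos-* 105 L))) (F-upper 7J≤105L)
    where
    L J : ℕ
    L = ⌊log₂ n ⌋
    J = 5 ℕ.* ℕ.suc L ℕ.+ 5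
    open Estimate F F0 F-leading-digit J n (ℕ.<-≤-trans (n<2^[1+⌊log₂n⌋] n) (2^n≤A[5n+5] (ℕ.suc L)))
    7J≤105L : 7 ℕ.* J ℕ.≤ 105 ℕ.* L
    7J≤105L = 7[5[1+n]+5]≤105n (⌊log₂⌋-mono-≤ n≥2)
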